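{- Let $\mu_0$ be any partition all of whose parts are at least $2$ (possibly empty). Define, for $n\ge|\mu_0|+1$, $$\phi^{(2)}_n\big(\mu_0 1^{n-|\mu_0|}\big)=\sum_{j=1}^{n}\chi^{(j,1^{n-j})}\big(\mu_0 1^{n-|\mu_0|}\big)^2 .$$ Then there exists a rational function $S_{\mu_0}(n)\in\mathbb{Q}(n)$ such that $\phi^{(2)}_n(\mu_0 1^{n-|\mu_0|})=S_{\mu_0}(n)\binom{2n-2}{n-1}$ for all integers $n\ge|\mu_0|+1$.
   Context: For partitions $\lambda,\mu$ of $n$, $\chi^{\lambda}(\mu)$ is the value of the irreducible character of $S_n$ indexed by $\lambda$ on permutations of cycle type $\mu$. $(j,1^{n-j})$ is the hook shape with first row of length $j$ and $n-j$ further rows of length $1$. $|\mu_0|$ is the sum of parts of $\mu_0$, and $\mu_0 1^{n-|\mu_0|}$ is the partition of $n$ obtained from $\mu_0$ by appending $n-|\mu_0|$ ones. -}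

module Defs where

open import Data.Nat as ℕ using (ℕ; zero; suc; _≤?_; _<?_; _≟_)
open import Data.Integer as ℤ using (ℤ; +_)
open import Data.Rational as ℚ using (ℚ)
open import Data.List using (List; []; _∷_; length; lookup; updateAt; allFin;
  zipWith; downFrom; replicate; _++_; map; foldr; filter; applyUpTo)
open import Data.Nat.ListAction using (sum)
open import Data.List.Relation.Unary.Any using (any?)
open import Data.List.Relation.Unary.All using (all?)
open import Data.Product using (_×_; _,_)
open import Relation.Nullary.Decidable using (does; _×-dec_)
open import Data.Bool using (if_then_else_; _∧_; not)

sumℤ : List ℤ → ℤ
sumℤ = foldr ℤ._+_ (+ 0)

signℤ : ℕ → ℤ
signℤ zero = + 1
signℤ (suc k) = ℤ.- signℤ k

-- Beta-set (first-column hook lengths) of a partition λ = [λ₁,…,λₖ]: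
-- βᵢ = λᵢ + (k - i).
betaSet : List ℕ → List ℕ
betaSet λ′ = zipWith ℕ._+_ λ′ (downFrom (length λ′))

-- All ways to remove a rim hook (border strip) of size r, in beta-set
-- (abacus) language: move a bead b to b ∸ r (with r ≤ b and b ∸ r not
-- already a bead). The sign is (-1)^(leg length) = (-1)^#(beads strictly
-- between b ∸ r and b).
removals : ℕ → List ℕ → List (ℤ × List ℕ)
removals r β = foldr step [] (allFin (length β))
  where
  step : _ → List (ℤ × List ℕ) → List (ℤ × List ℕ)
  step i acc =
    let b = lookup β i in
    if does (r ≤? b) ∧ not (does (any? (λ c → c ≟ (b ℕ.∸ r)) β))
    then (signℤ (length (filter (λ c → (b ℕ.∸ r) <? c ×-dec c <? b) β))
           , updateAt β i (λ _ → b ℕ.∸ r)) ∷ acc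
    else acc

-- The empty partition (with k beads) has beta-set {0,…,k-1}, i.e. all
-- k distinct beads lie below k.
emptyβ : List ℕ → ℤ
emptyβ β = if does (all? (λ c → c <? length β) β) then + 1 else + 0

chiβ : List ℕ → List ℕ → ℤ
chiβ β [] = emptyβ β
chiβ β (r ∷ μ) = sumℤ (map (λ { (s , β′) → s ℤ.* chiβ β′ μ }) (removals r β))

-- χ^λ(μ): irreducible character of S_n indexed by partition λ (parts in
-- weakly decreasing order) at cycle type μ, via Murnaghan–Nakayama.
χ : List ℕ → List ℕ → ℤ
χ λ′ μ = chiβ (betaSet λ′) μ

hook : ℕ → ℕ → List ℕ
hook n j = j ∷ replicate (n ℕ.∸ j) 1

pad : List ℕ → ℕ → List ℕ
pad μ₀ n = μ₀ ++ replicate (n ℕ.∸ sum μ₀) 1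

φ2 : List ℕ → ℕ → ℤ
φ2 μ₀ n = sumℤ (applyUpTo (λ i → let c = χ (hook n (suc i)) (pad μ₀ n) in c ℤ.* c) n)

-- Polynomials over ℚ as coefficient lists [a₀, a₁, …]; Horner evaluation.
evalPoly : List ℚ → ℚ → ℚ
evalPoly as x = foldr (λ a acc → a ℚ.+ x ℚ.* acc) ℚ.0ℚ as

ℕ→ℚ : ℕ → ℚ
ℕ→ℚ n = (+ n) ℚ./ 1

ℤ→ℚ : ℤ → ℚ
ℤ→ℚ z = z ℚ./ 1

-- In β-set (abacus) notation the hook (j, 1^(n−j)) is a head bead at n above the beads 1, …, n − j.
-- Removing the rim hooks of μ₀ 1^(n−|μ₀|) by the Murnaghan–Nakayama rule, a part r either slides
-- the head bead down by r or moves the gap in the block of low beads up by r (sign (−1)^(r−1));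
-- hence χ^(j,1^(n−j)) is the coefficient of x^(n−j) in (1 + x)^M ∏_{r ∈ μ₀} (1 − (−x)^r), where
-- M = n − |μ₀| − 1. Expanding the product as Σ_t c_t x^(d_t), Vandermonde's identity gives
-- φ⁽²⁾_n = Σ_{t,u} c_t c_u C(2M, M + |d_t − d_u|), and each C(2M, M + κ) is C(2n − 2, n − 1) times
-- a ratio of products of linear factors in n.

module Submission where

module Sums where

  open import Data.Nat using (ℕ; zero; suc; _∸_; _<_; z≤n; s≤s)
  import Data.Nat as ℕ
  open import Data.Integer using (ℤ; 0ℤ; _+_; _*_)
  open import Data.Integer.Properties
  open import Data.Integer.Tactic.RingSolver using (solve-∀)
  open import Data.List using (List; []; _∷_; _++_; map; applyUpTo)
  open import Data.List.Relation.Unary.All using (All; []; _∷_)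
  open import Relation.Binary.PropositionalEquality
  open import Defs using (sumℤ)

  ∑< : ℕ → (ℕ → ℤ) → ℤ
  ∑< zero    f = 0ℤ
  ∑< (suc n) f = f 0 + ∑< n (λ t → f (suc t))

  syntax ∑< n (λ l → e) = ∑[ l < n ] e

  ∑∈ : {A : Set} → List A → (A → ℤ) → ℤ
  ∑∈ []       f = 0ℤ
  ∑∈ (x ∷ xs) f = f x + ∑∈ xs f

  syntax ∑∈ xs (λ x → e) = ∑[ x ∈ xs ] e

  sumℤ-applyUpTo : ∀ n f → sumℤ (applyUpTo f n) ≡ ∑< n f
  sumℤ-applyUpTo zero    f = refl
  sumℤ-applyUpTo (suc n) f = cong (f 0 +_) (sumℤ-applyUpTo n (λ t → f (suc t)))

  ∑<-cong : ∀ n {f g} → (∀ t → t < n → f t ≡ g t) → ∑< n f ≡ ∑< n g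
  ∑<-cong zero    eq = refl
  ∑<-cong (suc n) eq = cong₂ _+_ (eq 0 (s≤s z≤n)) (∑<-cong n (λ t t<n → eq (suc t) (s≤s t<n)))

  ∑<-zero : ∀ n {f} → (∀ t → t < n → f t ≡ 0ℤ) → ∑< n f ≡ 0ℤ
  ∑<-zero zero    eq = refl
  ∑<-zero (suc n) eq =
    cong₂ _+_ (eq 0 (s≤s z≤n)) (∑<-zero n (λ t t<n → eq (suc t) (s≤s t<n)))

  ∑<-+ : ∀ n f g → ∑[ t < n ] (f t + g t) ≡ ∑< n f + ∑< n g
  ∑<-+ zero    f g = refl
  ∑<-+ (suc n) f g =
    trans (cong (f 0 + g 0 +_) (∑<-+ n (λ t → f (suc t)) (λ t → g (suc t))))
          (+-interchange (f 0) (g 0) _ _)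
    where
    +-interchange : ∀ a b c d → a + b + (c + d) ≡ a + c + (b + d)
    +-interchange = solve-∀

  ∑<-*ˡ : ∀ n c f → ∑[ t < n ] (c * f t) ≡ c * ∑< n f
  ∑<-*ˡ zero    c f = sym (*-zeroʳ c)
  ∑<-*ˡ (suc n) c f =
    trans (cong (c * f 0 +_) (∑<-*ˡ n c (λ t → f (suc t)))) (sym (*-distribˡ-+ c (f 0) _))

  ∑<-split : ∀ m n f → ∑< (m ℕ.+ n) f ≡ ∑< m f + ∑[ t < n ] f (m ℕ.+ t)
  ∑<-split zero    n f = sym (+-identityˡ _)
  ∑<-split (suc m) n f =
    trans (cong (f 0 +_) (∑<-split m n (λ t → f (suc t)))) (sym (+-assoc (f 0) _ _))

  ∑<-last : ∀ n f → ∑< (suc n) f ≡ ∑< n f + f n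
  ∑<-last zero    f = +-comm (f 0) 0ℤ
  ∑<-last (suc n) f =
    trans (cong (f 0 +_) (∑<-last n (λ t → f (suc t)))) (sym (+-assoc (f 0) _ _))

  ∑<-reverse : ∀ n f → ∑[ t < n ] f (n ∸ suc t) ≡ ∑< n f
  ∑<-reverse zero    f = refl
  ∑<-reverse (suc n) f =
    trans (cong (f n +_) (∑<-reverse n f)) (trans (+-comm (f n) _) (sym (∑<-last n f)))

  module _ {A : Set} where

    ∑∈-cong : ∀ (xs : List A) {f g} → (∀ x → f x ≡ g x) → ∑∈ xs f ≡ ∑∈ xs g
    ∑∈-cong []       eq = refl
    ∑∈-cong (x ∷ xs) eq = cong₂ _+_ (eq x) (∑∈-cong xs eq)

    ∑∈-congᴬ : ∀ {P : A → Set} {xs : List A} {f g} → All P xs →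
               (∀ x → P x → f x ≡ g x) → ∑∈ xs f ≡ ∑∈ xs g
    ∑∈-congᴬ []         eq = refl
    ∑∈-congᴬ (px ∷ pxs) eq = cong₂ _+_ (eq _ px) (∑∈-congᴬ pxs eq)

    ∑∈-zero : ∀ (xs : List A) → ∑[ x ∈ xs ] 0ℤ ≡ 0ℤ
    ∑∈-zero []       = refl
    ∑∈-zero (x ∷ xs) = trans (+-identityˡ _) (∑∈-zero xs)

    ∑∈-++ : ∀ (xs ys : List A) f → ∑∈ (xs ++ ys) f ≡ ∑∈ xs f + ∑∈ ys f
    ∑∈-++ []       ys f = sym (+-identityˡ _)
    ∑∈-++ (x ∷ xs) ys f = trans (cong (f x +_) (∑∈-++ xs ys f)) (sym (+-assoc (f x) _ _))

    ∑∈-*ˡ : ∀ (xs : List A) c f → ∑[ x ∈ xs ] (c * f x) ≡ c * ∑∈ xs f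
    ∑∈-*ˡ []       c f = sym (*-zeroʳ c)
    ∑∈-*ˡ (x ∷ xs) c f =
      trans (cong (c * f x +_) (∑∈-*ˡ xs c f)) (sym (*-distribˡ-+ c (f x) _))

    ∑∈-*ʳ : ∀ (xs : List A) c f → ∑[ x ∈ xs ] (f x * c) ≡ ∑∈ xs f * c
    ∑∈-*ʳ xs c f =
      trans (∑∈-cong xs (λ x → *-comm (f x) c)) (trans (∑∈-*ˡ xs c f) (*-comm c _))

    ∑∈-product : ∀ (xs ys : List A) f g →
                 ∑∈ xs f * ∑∈ ys g ≡ ∑[ x ∈ xs ] ∑[ y ∈ ys ] (f x * g y)
    ∑∈-product []       ys f g = *-zeroˡ (∑∈ ys g)
    ∑∈-product (x ∷ xs) ys f g =
      trans (*-distribʳ-+ (∑∈ ys g) (f x) (∑∈ xs f))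
            (cong₂ _+_ (sym (∑∈-*ˡ ys (f x) g)) (∑∈-product xs ys f g))

    ∑<-∑∈-comm : ∀ n (xs : List A) (F : ℕ → A → ℤ) →
                 ∑[ l < n ] ∑[ x ∈ xs ] F l x ≡ ∑[ x ∈ xs ] ∑[ l < n ] F l x
    ∑<-∑∈-comm n []       F = ∑<-zero n (λ _ _ → refl)
    ∑<-∑∈-comm n (x ∷ xs) F =
      trans (∑<-+ n (λ l → F l x) (λ l → ∑∈ xs (F l)))
            (cong (∑< n (λ l → F l x) +_) (∑<-∑∈-comm n xs F))

  ∑∈-map : ∀ {A B : Set} (g : A → B) (xs : List A) f → ∑∈ (map g xs) f ≡ ∑[ x ∈ xs ] f (g x)
  ∑∈-map g []       f = refl
  ∑∈-map g (x ∷ xs) f = cong (f (g x) +_) (∑∈-map g xs f)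


module Binomial where

  open import Data.Nat using (ℕ; zero; suc; _∸_; _≤_; _<_; s≤s)
  import Data.Nat as ℕ
  import Data.Nat.Properties as ℕ
  open import Data.Nat.Combinatorics using (_C_; nCk+nC[k+1]≡[n+1]C[k+1])
  open import Data.Integer using (ℤ; +_; 0ℤ; 1ℤ; _+_; _*_; _-_)
  open import Data.Integer.Properties
  open import Data.Integer.Tactic.RingSolver using (solve-∀)
  open import Data.Product using (_,_)
  open import Relation.Binary.PropositionalEquality
  open ≡-Reasoning
  open Sums
  open import Data.Nat.Tactic.RingSolver using () renaming (solve-∀ to ℕ-solve-∀)

  -- Pascal's rule holds here by definition, unlike for `_C_`.
  binomial : ℕ → ℕ → ℤ
  binomial n       zero    = 1ℤ
  binomial zero    (suc k) = 0ℤ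
  binomial (suc n) (suc k) = binomial n k + binomial n (suc k)

  binomial≡C : ∀ n k → binomial n k ≡ + (n C k)
  binomial≡C n       zero    = refl
  binomial≡C zero    (suc k) = refl
  binomial≡C (suc n) (suc k) =
    trans (cong₂ _+_ (binomial≡C n k) (binomial≡C n (suc k)))
          (cong +_ (nCk+nC[k+1]≡[n+1]C[k+1] n k))

  binomial-> : ∀ {n k} → n < k → binomial n k ≡ 0ℤ
  binomial-> {zero}  {suc k} _         = refl
  binomial-> {suc n} {suc k} (s≤s n<k) =
    cong₂ _+_ (binomial-> n<k) (binomial-> (ℕ.m<n⇒m<1+n n<k))

  vandermonde : ∀ a b c R → a < R →
                ∑[ t < R ] (binomial a t * binomial b (c ℕ.+ t)) ≡ binomial (a ℕ.+ b) (a ℕ.+ c)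
  vandermonde zero b c (suc R) _ = begin
    1ℤ * binomial b (c ℕ.+ 0) + ∑[ t < R ] (0ℤ * binomial b (c ℕ.+ suc t))
      ≡⟨ cong₂ _+_ (*-identityˡ (binomial b (c ℕ.+ 0)))
                   (∑<-zero R (λ t _ → *-zeroˡ (binomial b (c ℕ.+ suc t)))) ⟩
    binomial b (c ℕ.+ 0) + 0ℤ
      ≡⟨ trans (+-identityʳ _) (cong (binomial b) (ℕ.+-identityʳ c)) ⟩
    binomial b c ∎
  vandermonde (suc a) b c (suc R) (s≤s a<R) = begin
    1ℤ * binomial b (c ℕ.+ 0)
      + ∑[ t < R ] ((binomial a t + binomial a (suc t)) * binomial b (c ℕ.+ suc t))
      ≡⟨ cong (_+_ (1ℤ * binomial b (c ℕ.+ 0)))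
              (trans (∑<-cong R (λ t _ → pascal-term t)) (∑<-+ R f g)) ⟩
    1ℤ * binomial b (c ℕ.+ 0) + (∑< R f + ∑< R g)
      ≡⟨ regroup (1ℤ * binomial b (c ℕ.+ 0)) (∑< R f) (∑< R g) ⟩
    (1ℤ * binomial b (c ℕ.+ 0) + ∑< R g) + ∑< R f
      ≡⟨ cong₂ _+_ (vandermonde a b c (suc R) (ℕ.m<n⇒m<1+n a<R)) (vandermonde a b (suc c) R a<R) ⟩
    binomial (a ℕ.+ b) (a ℕ.+ c) + binomial (a ℕ.+ b) (a ℕ.+ suc c)
      ≡⟨ cong (λ k → binomial (a ℕ.+ b) (a ℕ.+ c) + binomial (a ℕ.+ b) k) (ℕ.+-suc a c) ⟩
    binomial (suc a ℕ.+ b) (suc a ℕ.+ c) ∎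
    where
    f g : ℕ → ℤ
    f t = binomial a t * binomial b (suc c ℕ.+ t)
    g t = binomial a (suc t) * binomial b (c ℕ.+ suc t)
    pascal-term : ∀ t → (binomial a t + binomial a (suc t)) * binomial b (c ℕ.+ suc t) ≡ f t + g t
    pascal-term t = trans (*-distribʳ-+ _ (binomial a t) _)
                          (cong (λ k → binomial a t * binomial b k + g t) (ℕ.+-suc c t))
    regroup : ∀ x y z → x + (y + z) ≡ (x + z) + y
    regroup = solve-∀

  -- Mutual induction on the top entry: absorb-bottom at m + 1 is absorb-both followed by absorb-top at m.
  absorb-bottom : ∀ m k → + suc k * binomial m (suc k) ≡ (+ m - + k) * binomial m k
  absorb-both   : ∀ n k → + suc k * binomial (suc n) (suc k) ≡ + suc n * binomial n k
  absorb-top    : ∀ a b → (+ suc a - + b) * binomial (suc a) b ≡ + suc a * binomial a b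

  absorb-bottom zero    zero    = refl
  absorb-bottom zero    (suc k) = trans (*-zeroʳ (+ suc (suc k))) (sym (*-zeroʳ (0ℤ - + suc k)))
  absorb-bottom (suc m) k       = trans (absorb-both m k) (sym (absorb-top m k))

  absorb-both n k = begin
    + suc k * (binomial n k + binomial n (suc k))
      ≡⟨ *-distribˡ-+ (+ suc k) (binomial n k) (binomial n (suc k)) ⟩
    + suc k * binomial n k + + suc k * binomial n (suc k)
      ≡⟨ cong (_+_ (+ suc k * binomial n k)) (absorb-bottom n k) ⟩
    + suc k * binomial n k + (+ n - + k) * binomial n k
      ≡⟨ collect (+ k) (+ n) (binomial n k) ⟩
    + suc n * binomial n k ∎
    where
    collect : ∀ k n x → (1ℤ + k) * x + (n - k) * x ≡ (1ℤ + n) * x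
    collect = solve-∀

  absorb-top a zero = minus-zero (+ suc a)
    where
    minus-zero : ∀ x → (x - 0ℤ) * 1ℤ ≡ x * 1ℤ
    minus-zero = solve-∀
  absorb-top a (suc k) = begin
    (+ suc a - + suc k) * (binomial a k + binomial a (suc k))
      ≡⟨ cong (_* (binomial a k + binomial a (suc k))) (cancel (+ a) (+ k)) ⟩
    (+ a - + k) * (binomial a k + binomial a (suc k))
      ≡⟨ *-distribˡ-+ (+ a - + k) (binomial a k) (binomial a (suc k)) ⟩
    (+ a - + k) * binomial a k + (+ a - + k) * binomial a (suc k)
      ≡⟨ cong (_+ (+ a - + k) * binomial a (suc k)) (sym (absorb-bottom a k)) ⟩
    + suc k * binomial a (suc k) + (+ a - + k) * binomial a (suc k)
      ≡⟨ collect (+ k) (+ a) (binomial a (suc k)) ⟩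
    + suc a * binomial a (suc k) ∎
    where
    cancel : ∀ a k → (1ℤ + a) - (1ℤ + k) ≡ a - k
    cancel = solve-∀
    collect : ∀ k n x → (1ℤ + k) * x + (n - k) * x ≡ (1ℤ + n) * x
    collect = solve-∀

  rising : ℤ → ℕ → ℤ
  rising x zero    = 1ℤ
  rising x (suc u) = rising x u * (+ suc u + x)

  rising-+ : ∀ x u v → rising x (v ℕ.+ u) ≡ rising x u * rising (+ u + x) v
  rising-+ x u zero    = sym (*-identityʳ (rising x u))
  rising-+ x u (suc v) = begin
    rising x (v ℕ.+ u) * (+ suc (v ℕ.+ u) + x)
      ≡⟨ cong (_* (+ suc (v ℕ.+ u) + x)) (rising-+ x u v) ⟩
    rising x u * rising (+ u + x) v * (+ suc (v ℕ.+ u) + x)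
      ≡⟨ reassociate (rising x u) (rising (+ u + x) v) x (+ u) (+ v) ⟩
    rising x u * (rising (+ u + x) v * (+ suc v + (+ u + x))) ∎
    where
    reassociate : ∀ a b x u v → a * b * (1ℤ + v + u + x) ≡ a * (b * (1ℤ + v + (u + x)))
    reassociate = solve-∀

  binomial-rising-both : ∀ u a b →
    binomial (u ℕ.+ a) (u ℕ.+ b) * rising (+ b) u ≡ rising (+ a) u * binomial a b
  binomial-rising-both zero    a b = trans (*-identityʳ (binomial a b)) (sym (*-identityˡ (binomial a b)))
  binomial-rising-both (suc u) a b = begin
    binomial (suc (u ℕ.+ a)) (suc (u ℕ.+ b)) * (rising (+ b) u * + suc (u ℕ.+ b))
      ≡⟨ rotate (binomial (suc (u ℕ.+ a)) (suc (u ℕ.+ b))) (rising (+ b) u) (+ suc (u ℕ.+ b)) ⟩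
    + suc (u ℕ.+ b) * binomial (suc (u ℕ.+ a)) (suc (u ℕ.+ b)) * rising (+ b) u
      ≡⟨ cong (_* rising (+ b) u) (absorb-both (u ℕ.+ a) (u ℕ.+ b)) ⟩
    + suc (u ℕ.+ a) * binomial (u ℕ.+ a) (u ℕ.+ b) * rising (+ b) u
      ≡⟨ *-assoc (+ suc (u ℕ.+ a)) (binomial (u ℕ.+ a) (u ℕ.+ b)) (rising (+ b) u) ⟩
    + suc (u ℕ.+ a) * (binomial (u ℕ.+ a) (u ℕ.+ b) * rising (+ b) u)
      ≡⟨ cong (+ suc (u ℕ.+ a) *_) (binomial-rising-both u a b) ⟩
    + suc (u ℕ.+ a) * (rising (+ a) u * binomial a b)
      ≡⟨ swap (+ suc (u ℕ.+ a)) (rising (+ a) u) (binomial a b) ⟩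
    rising (+ a) u * + suc (u ℕ.+ a) * binomial a b ∎
    where
    rotate : ∀ x y z → x * (y * z) ≡ z * x * y
    rotate = solve-∀
    swap : ∀ x y z → x * (y * z) ≡ y * x * z
    swap = solve-∀

  binomial-rising-top : ∀ v a b →
    binomial (v ℕ.+ a) b * rising (+ a - + b) v ≡ rising (+ a) v * binomial a b
  binomial-rising-top zero    a b = trans (*-identityʳ (binomial a b)) (sym (*-identityˡ (binomial a b)))
  binomial-rising-top (suc v) a b = begin
    binomial (suc (v ℕ.+ a)) b * (rising (+ a - + b) v * (+ suc v + (+ a - + b)))
      ≡⟨ rotate (binomial (suc (v ℕ.+ a)) b) (rising (+ a - + b) v) (+ v) (+ a) (+ b) ⟩
    (+ suc (v ℕ.+ a) - + b) * binomial (suc (v ℕ.+ a)) b * rising (+ a - + b) v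
      ≡⟨ cong (_* rising (+ a - + b) v) (absorb-top (v ℕ.+ a) b) ⟩
    + suc (v ℕ.+ a) * binomial (v ℕ.+ a) b * rising (+ a - + b) v
      ≡⟨ *-assoc (+ suc (v ℕ.+ a)) (binomial (v ℕ.+ a) b) (rising (+ a - + b) v) ⟩
    + suc (v ℕ.+ a) * (binomial (v ℕ.+ a) b * rising (+ a - + b) v)
      ≡⟨ cong (+ suc (v ℕ.+ a) *_) (binomial-rising-top v a b) ⟩
    + suc (v ℕ.+ a) * (rising (+ a) v * binomial a b)
      ≡⟨ swap (+ suc (v ℕ.+ a)) (rising (+ a) v) (binomial a b) ⟩
    rising (+ a) v * + suc (v ℕ.+ a) * binomial a b ∎
    where
    rotate : ∀ B r v a b → B * (r * (1ℤ + v + (a - b))) ≡ (1ℤ + v + a - b) * B * r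
    rotate = solve-∀
    swap : ∀ x y z → x * (y * z) ≡ y * x * z
    swap = solve-∀

  -- In factorials: C(2M, M+κ) · (2M+2s)!/(2M)! = (M+s)!/(M+κ)! · (M+s)!/(M−κ)! · C(2M+2s, M+s);
  -- for κ > M both sides vanish. The proof splits (2M+1)⋯(2M+2s) after j = s − κ factors: the
  -- first j turn C(2M, M+κ) into C(2M+j, M+s), the remaining s + κ turn that into C(2M+2s, M+s).
  binomial-ratio : ∀ M s κ → κ ≤ s →
    binomial (M ℕ.+ M) (M ℕ.+ κ) * rising (+ (M ℕ.+ M)) (s ℕ.+ s)
      ≡ rising (+ (M ℕ.+ κ)) (s ∸ κ) * rising (+ M - + κ) (s ℕ.+ κ)
        * binomial (M ℕ.+ M ℕ.+ (s ℕ.+ s)) (M ℕ.+ s)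
  binomial-ratio M s κ κ≤s with ℕ.m≤n⇒∃[o]m+o≡n κ≤s
  ... | j , refl rewrite ℕ.m+n∸m≡n κ j = begin
    A * rising (+ (M ℕ.+ M)) (s ℕ.+ s)
      ≡⟨ cong (A *_) (trans (cong (rising (+ (M ℕ.+ M))) (s+s≡v+j M κ j))
                            (rising-+ (+ (M ℕ.+ M)) j v)) ⟩
    A * (r₂ * r₄)
      ≡⟨ swap₁ A r₂ r₄ ⟩
    r₄ * (r₂ * A)
      ≡⟨ cong (r₄ *_) (sym (binomial-rising-both j (M ℕ.+ M) (M ℕ.+ κ))) ⟩
    r₄ * (B * r₁)
      ≡⟨ swap₂ r₄ B r₁ ⟩
    r₁ * (r₄ * B)
      ≡⟨ cong (r₁ *_) (sym top-step) ⟩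
    r₁ * (D * r₃)
      ≡⟨ swap₃ r₁ D r₃ ⟩
    r₁ * r₃ * D ∎
    where
    v = s ℕ.+ κ
    A = binomial (M ℕ.+ M) (M ℕ.+ κ)
    B = binomial (j ℕ.+ (M ℕ.+ M)) (j ℕ.+ (M ℕ.+ κ))
    D = binomial (M ℕ.+ M ℕ.+ (s ℕ.+ s)) (M ℕ.+ s)
    r₁ = rising (+ (M ℕ.+ κ)) j
    r₂ = rising (+ (M ℕ.+ M)) j
    r₃ = rising (+ M - + κ) v
    r₄ = rising (+ (j ℕ.+ (M ℕ.+ M))) v
    s+s≡v+j : ∀ M κ j → (κ ℕ.+ j) ℕ.+ (κ ℕ.+ j) ≡ (κ ℕ.+ j ℕ.+ κ) ℕ.+ j
    s+s≡v+j = ℕ-solve-∀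
    top-step : D * r₃ ≡ r₄ * B
    top-step = begin
      D * r₃
        ≡⟨ cong₂ (λ p q → binomial p q * r₃) (top M κ j) (bottom M κ j) ⟩
      binomial (v ℕ.+ (j ℕ.+ (M ℕ.+ M))) (j ℕ.+ (M ℕ.+ κ)) * r₃
        ≡⟨ cong (λ x → binomial (v ℕ.+ (j ℕ.+ (M ℕ.+ M))) (j ℕ.+ (M ℕ.+ κ)) * rising x v)
                (sym (difference (+ M) (+ κ) (+ j))) ⟩
      binomial (v ℕ.+ (j ℕ.+ (M ℕ.+ M))) (j ℕ.+ (M ℕ.+ κ))
        * rising (+ (j ℕ.+ (M ℕ.+ M)) - + (j ℕ.+ (M ℕ.+ κ))) v
        ≡⟨ binomial-rising-top v (j ℕ.+ (M ℕ.+ M)) (j ℕ.+ (M ℕ.+ κ)) ⟩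
      r₄ * B ∎
      where
      top : ∀ M κ j →
            M ℕ.+ M ℕ.+ ((κ ℕ.+ j) ℕ.+ (κ ℕ.+ j)) ≡ (κ ℕ.+ j ℕ.+ κ) ℕ.+ (j ℕ.+ (M ℕ.+ M))
      top = ℕ-solve-∀
      bottom : ∀ M κ j → M ℕ.+ (κ ℕ.+ j) ≡ j ℕ.+ (M ℕ.+ κ)
      bottom = ℕ-solve-∀
      difference : ∀ M κ j → j + (M + M) - (j + (M + κ)) ≡ M - κ
      difference = solve-∀
    swap₁ : ∀ a b c → a * (b * c) ≡ c * (b * a)
    swap₁ = solve-∀
    swap₂ : ∀ a b c → a * (b * c) ≡ c * (a * b)
    swap₂ = solve-∀
    swap₃ : ∀ a b c → a * (b * c) ≡ a * c * b
    swap₃ = solve-∀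

  rising-≢0 : ∀ x u → rising (+ x) u ≢ 0ℤ
  rising-≢0 x zero    ()
  rising-≢0 x (suc u) eq = rising-≢0 x u (*-cancelʳ-≡ (rising (+ x) u) 0ℤ (+ suc u + + x) eq)


module Series where

  open import Data.Nat using (ℕ; zero; suc; _∸_; _≤_; _<_; ∣_-_∣; z≤n; s≤s)
  import Data.Nat as ℕ
  import Data.Nat.Properties as ℕ
  open import Data.Nat.ListAction using (sum)
  open import Data.Integer using (ℤ; 0ℤ; 1ℤ; _+_; _*_)
  open import Data.Integer.Properties
  open import Data.List using (List; []; _∷_; _++_; map; replicate; [_])
  open import Data.List.Relation.Unary.All using (All; []; _∷_)
  import Data.List.Relation.Unary.All as All
  import Data.List.Relation.Unary.All.Properties as All
  open import Data.Product using (_×_; _,_; proj₁)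
  open import Data.Sum using (inj₁; inj₂)
  open import Relation.Binary.PropositionalEquality
    using (_≡_; refl; sym; trans; cong; cong₂; subst; module ≡-Reasoning)
  open ≡-Reasoning
  open import Defs using (signℤ)
  open Sums
  open Binomial

  -- shift d f is the coefficient sequence of x^d · f(x).
  shift : ℕ → (ℕ → ℤ) → ℕ → ℤ
  shift zero    f l       = f l
  shift (suc d) f zero    = 0ℤ
  shift (suc d) f (suc l) = shift d f l

  shift-≥ : ∀ {d l} f → d ≤ l → shift d f l ≡ f (l ∸ d)
  shift-≥ {zero}            f _         = refl
  shift-≥ {suc d} {suc l}   f (s≤s d≤l) = shift-≥ f d≤l

  shift-< : ∀ {d l} f → l < d → shift d f l ≡ 0ℤ
  shift-< {suc d} {zero}  f _         = refl
  shift-< {suc d} {suc l} f (s≤s l<d) = shift-< f l<d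

  shift-+ˡ : ∀ d f t → shift d f (d ℕ.+ t) ≡ f t
  shift-+ˡ zero    f t = refl
  shift-+ˡ (suc d) f t = shift-+ˡ d f t

  shift-+ : ∀ d e f l → shift (d ℕ.+ e) f l ≡ shift d (shift e f) l
  shift-+ zero    e f l       = refl
  shift-+ (suc d) e f zero    = refl
  shift-+ (suc d) e f (suc l) = shift-+ d e f l

  shift-cong : ∀ d {f g} → (∀ l → f l ≡ g l) → ∀ l → shift d f l ≡ shift d g l
  shift-cong zero    eq l       = eq l
  shift-cong (suc d) eq zero    = refl
  shift-cong (suc d) eq (suc l) = shift-cong d eq l

  shift-linear : ∀ {A : Set} d (xs : List A) (c : A → ℤ) (F : A → ℕ → ℤ) l →
    shift d (λ l → ∑[ x ∈ xs ] (c x * F x l)) l ≡ ∑[ x ∈ xs ] (c x * shift d (F x) l)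
  shift-linear zero    xs c F l       = refl
  shift-linear (suc d) xs c F zero    =
    sym (trans (∑∈-cong xs (λ x → *-zeroʳ (c x))) (∑∈-zero xs))
  shift-linear (suc d) xs c F (suc l) = shift-linear d xs c F l

  -- For parts r ≥ 1, cycleProduct μ f is the coefficient sequence of f(x) · ∏_{r ∈ μ} (1 − (−x)^r).
  cycleProduct : List ℕ → (ℕ → ℤ) → ℕ → ℤ
  cycleProduct []      f l = f l
  cycleProduct (r ∷ μ) f l = cycleProduct μ f l + signℤ (r ∸ 1) * shift r (cycleProduct μ f) l

  cycleProduct-cong : ∀ μ {f g} → (∀ l → f l ≡ g l) →
                      ∀ l → cycleProduct μ f l ≡ cycleProduct μ g l
  cycleProduct-cong []      eq l = eq l
  cycleProduct-cong (r ∷ μ) eq l =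
    cong₂ (λ a b → a + signℤ (r ∸ 1) * b)
          (cycleProduct-cong μ eq l) (shift-cong r (cycleProduct-cong μ eq) l)

  cycleProduct-++ : ∀ μ ν f l → cycleProduct (μ ++ ν) f l ≡ cycleProduct μ (cycleProduct ν f) l
  cycleProduct-++ []      ν f l = refl
  cycleProduct-++ (r ∷ μ) ν f l =
    cong₂ (λ a b → a + signℤ (r ∸ 1) * b)
          (cycleProduct-++ μ ν f l) (shift-cong r (cycleProduct-++ μ ν f) l)

  cycleProduct-ones : ∀ m l → cycleProduct (replicate m 1) (binomial 0) l ≡ binomial m l
  cycleProduct-ones zero    l       = refl
  cycleProduct-ones (suc m) zero    rewrite cycleProduct-ones m zero = refl
  cycleProduct-ones (suc m) (suc l) rewrite cycleProduct-ones m (suc l) | cycleProduct-ones m l =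
    trans (cong (binomial m (suc l) +_) (*-identityˡ (binomial m l)))
          (+-comm (binomial m (suc l)) (binomial m l))

  VanishesFrom : ℕ → (ℕ → ℤ) → Set
  VanishesFrom D f = ∀ l → D ≤ l → f l ≡ 0ℤ

  shift-vanishes : ∀ r {D f} → VanishesFrom D f → VanishesFrom (r ℕ.+ D) (shift r f)
  shift-vanishes r {D} f-vanishes l r+D≤l =
    trans (shift-≥ _ (ℕ.≤-trans (ℕ.m≤m+n r D) r+D≤l))
          (f-vanishes (l ∸ r) (subst (_≤ l ∸ r) (ℕ.m+n∸m≡n r D) (ℕ.∸-monoˡ-≤ r r+D≤l)))

  cycleProduct-vanishes : ∀ μ {D f} → VanishesFrom D f → VanishesFrom (sum μ ℕ.+ D) (cycleProduct μ f)
  cycleProduct-vanishes []      f-vanishes = f-vanishes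
  cycleProduct-vanishes (r ∷ μ) {D} f-vanishes l le = begin
    cycleProduct μ _ l + signℤ (r ∸ 1) * shift r (cycleProduct μ _) l
      ≡⟨ cong₂ (λ a b → a + signℤ (r ∸ 1) * b)
               (cycleProduct-vanishes μ f-vanishes l (ℕ.≤-trans (ℕ.m≤n+m _ r) le′))
               (shift-vanishes r (cycleProduct-vanishes μ f-vanishes) l le′) ⟩
    0ℤ + signℤ (r ∸ 1) * 0ℤ
      ≡⟨ trans (+-identityˡ _) (*-zeroʳ (signℤ (r ∸ 1))) ⟩
    0ℤ ∎
    where
    le′ : r ℕ.+ (sum μ ℕ.+ D) ≤ l
    le′ = subst (_≤ l) (ℕ.+-assoc r (sum μ) D) le

  monomials : List ℕ → List (ℤ × ℕ)
  monomials []      = [ 1ℤ , 0 ]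
  monomials (r ∷ μ) = monomials μ ++ map (λ (c , d) → signℤ (r ∸ 1) * c , r ℕ.+ d) (monomials μ)

  monomials-degree : ∀ μ → All (λ (_ , d) → d ≤ sum μ) (monomials μ)
  monomials-degree []      = z≤n ∷ []
  monomials-degree (r ∷ μ) =
    All.++⁺ (All.map (λ d≤ → ℕ.≤-trans d≤ (ℕ.m≤n+m (sum μ) r)) (monomials-degree μ))
            (All.map⁺ (All.map (ℕ.+-monoʳ-≤ r) (monomials-degree μ)))

  cycleProduct-expand : ∀ μ f l →
    cycleProduct μ f l ≡ ∑[ (c , d) ∈ monomials μ ] (c * shift d f l)
  cycleProduct-expand []      f l = sym (trans (+-identityʳ (1ℤ * f l)) (*-identityˡ (f l)))
  cycleProduct-expand (r ∷ μ) f l = sym (begin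
    ∑[ (c , d) ∈ monomials μ ++ map twist (monomials μ) ] (c * shift d f l)
      ≡⟨ ∑∈-++ (monomials μ) (map twist (monomials μ)) _ ⟩
    ∑[ (c , d) ∈ monomials μ ] (c * shift d f l)
      + ∑[ (c , d) ∈ map twist (monomials μ) ] (c * shift d f l)
      ≡⟨ cong₂ _+_ (sym (cycleProduct-expand μ f l)) (trans (∑∈-map twist (monomials μ) _) twisted) ⟩
    cycleProduct μ f l + ε * shift r (cycleProduct μ f) l ∎)
    where
    ε = signℤ (r ∸ 1)
    twist : ℤ × ℕ → ℤ × ℕ
    twist (c , d) = ε * c , r ℕ.+ d
    twisted : ∑[ (c , d) ∈ monomials μ ] (ε * c * shift (r ℕ.+ d) f l) ≡ ε * shift r (cycleProduct μ f) l
    twisted = begin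
      ∑[ (c , d) ∈ monomials μ ] (ε * c * shift (r ℕ.+ d) f l)
        ≡⟨ ∑∈-cong (monomials μ) (λ (c , d) →
             trans (*-assoc ε c _) (cong (λ x → ε * (c * x)) (shift-+ r d f l))) ⟩
      ∑[ (c , d) ∈ monomials μ ] (ε * (c * shift r (shift d f) l))
        ≡⟨ ∑∈-*ˡ (monomials μ) ε _ ⟩
      ε * ∑[ (c , d) ∈ monomials μ ] (c * shift r (shift d f) l)
        ≡⟨ cong (ε *_) (sym (shift-linear r (monomials μ) proj₁ (λ (_ , d) → shift d f) l)) ⟩
      ε * shift r (λ l → ∑[ (c , d) ∈ monomials μ ] (c * shift d f l)) l
        ≡⟨ cong (ε *_) (shift-cong r (λ l → sym (cycleProduct-expand μ f l)) l) ⟩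
      ε * shift r (cycleProduct μ f) l ∎

  module _ (M : ℕ) where

    private
      B : ℕ → ℤ
      B = binomial M

    correlation-≤ : ∀ {n d e} → e ℕ.+ M < n → d ≤ e →
      ∑[ l < n ] (shift d B l * shift e B l) ≡ binomial (M ℕ.+ M) (M ℕ.+ (e ∸ d))
    correlation-≤ {n} {d} {e} e+M<n d≤e = begin
      ∑[ l < n ] (shift d B l * shift e B l)
        ≡⟨ cong (λ n → ∑[ l < n ] (shift d B l * shift e B l)) (sym (ℕ.m+[n∸m]≡n e≤n)) ⟩
      ∑[ l < e ℕ.+ R ] (shift d B l * shift e B l)
        ≡⟨ ∑<-split e R _ ⟩
      ∑[ l < e ] (shift d B l * shift e B l) + ∑[ t < R ] (shift d B (e ℕ.+ t) * shift e B (e ℕ.+ t))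
        ≡⟨ cong₂ _+_ (∑<-zero e (λ l l<e →
                        trans (cong (shift d B l *_) (shift-< B l<e)) (*-zeroʳ (shift d B l))))
                     (∑<-cong R (λ t _ → aligned t)) ⟩
      0ℤ + ∑[ t < R ] (B t * B ((e ∸ d) ℕ.+ t))
        ≡⟨ +-identityˡ _ ⟩
      ∑[ t < R ] (B t * B ((e ∸ d) ℕ.+ t))
        ≡⟨ vandermonde M M (e ∸ d) R M<R ⟩
      binomial (M ℕ.+ M) (M ℕ.+ (e ∸ d)) ∎
      where
      R = n ∸ e
      e≤n : e ≤ n
      e≤n = ℕ.≤-trans (ℕ.m≤m+n e M) (ℕ.<⇒≤ e+M<n)
      M<R : M < R
      M<R = subst (_< R) (ℕ.m+n∸m≡n e M) (ℕ.∸-monoˡ-< e+M<n (ℕ.m≤m+n e M))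
      aligned : ∀ t → shift d B (e ℕ.+ t) * shift e B (e ℕ.+ t) ≡ B t * B ((e ∸ d) ℕ.+ t)
      aligned t = begin
        shift d B (e ℕ.+ t) * shift e B (e ℕ.+ t)
          ≡⟨ cong₂ _*_ (cong (shift d B) e+t≡d+[e∸d+t]) (shift-+ˡ e B t) ⟩
        shift d B (d ℕ.+ ((e ∸ d) ℕ.+ t)) * B t
          ≡⟨ cong (_* B t) (shift-+ˡ d B ((e ∸ d) ℕ.+ t)) ⟩
        B ((e ∸ d) ℕ.+ t) * B t
          ≡⟨ *-comm (B ((e ∸ d) ℕ.+ t)) (B t) ⟩
        B t * B ((e ∸ d) ℕ.+ t) ∎
        where
        e+t≡d+[e∸d+t] : e ℕ.+ t ≡ d ℕ.+ ((e ∸ d) ℕ.+ t)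
        e+t≡d+[e∸d+t] = trans (cong (ℕ._+ t) (sym (ℕ.m+[n∸m]≡n d≤e))) (ℕ.+-assoc d (e ∸ d) t)

    correlation : ∀ {s n d e} → s ℕ.+ M < n → d ≤ s → e ≤ s →
      ∑[ l < n ] (shift d B l * shift e B l) ≡ binomial (M ℕ.+ M) (M ℕ.+ ∣ d - e ∣)
    correlation {s} {n} {d} {e} s+M<n d≤s e≤s with ℕ.≤-total d e
    ... | inj₁ d≤e = begin
      ∑[ l < n ] (shift d B l * shift e B l)
        ≡⟨ correlation-≤ (ℕ.≤-<-trans (ℕ.+-monoˡ-≤ M e≤s) s+M<n) d≤e ⟩
      binomial (M ℕ.+ M) (M ℕ.+ (e ∸ d))
        ≡⟨ cong (λ k → binomial (M ℕ.+ M) (M ℕ.+ k)) (sym (ℕ.m≤n⇒∣m-n∣≡n∸m d≤e)) ⟩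
      binomial (M ℕ.+ M) (M ℕ.+ ∣ d - e ∣) ∎
    ... | inj₂ e≤d = begin
      ∑[ l < n ] (shift d B l * shift e B l)
        ≡⟨ ∑<-cong n (λ l _ → *-comm (shift d B l) (shift e B l)) ⟩
      ∑[ l < n ] (shift e B l * shift d B l)
        ≡⟨ correlation-≤ (ℕ.≤-<-trans (ℕ.+-monoˡ-≤ M d≤s) s+M<n) e≤d ⟩
      binomial (M ℕ.+ M) (M ℕ.+ (d ∸ e))
        ≡⟨ cong (λ k → binomial (M ℕ.+ M) (M ℕ.+ k)) (sym (ℕ.m≤n⇒∣n-m∣≡n∸m e≤d)) ⟩
      binomial (M ℕ.+ M) (M ℕ.+ ∣ d - e ∣) ∎


module Abacus where

  open import Data.Nat using (ℕ; zero; suc; _+_; _∸_; _≤_; _<_; z≤n; s≤s; _≟_; _<?_; _≤?_)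
  open import Data.Nat.Properties
  open import Data.List using (List; []; _∷_; length; filter; lookup; updateAt; removeAt)
  open import Data.List.Properties using (filter-accept; filter-reject)
  open import Data.List.Relation.Unary.Any using (Any; here; there)
  open import Data.List.Relation.Unary.All using (All; []; _∷_)
  import Data.List.Relation.Unary.All as All
  open import Data.List.Relation.Binary.Permutation.Propositional
    using (_↭_; refl; prep; swap; trans; ↭-sym; module PermutationReasoning)
  open import Data.List.Relation.Binary.Permutation.Propositional.Properties
    using (drop-∷; ↭-length; filter-↭)
  open import Data.Fin using (Fin)
  import Data.Fin as Fin
  open import Data.Product using (_×_; _,_; proj₁; map₁)
  open import Data.Empty using (⊥-elim)
  open import Function using (_∘_)
  open import Relation.Nullary using (yes; no)
  open import Relation.Nullary.Decidable using (_×-dec_)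
  open import Relation.Binary.PropositionalEquality as ≡ using (_≡_; _≢_; cong; ≢-sym)

  Occupied : List ℕ → ℕ → Set
  Occupied β b = Any (_≡ b) β

  gapped : ℕ → ℕ → List ℕ
  gapped zero    g = []
  gapped (suc K) g with K ≟ g
  ... | yes _ = gapped K g
  ... | no  _ = K ∷ gapped K g

  gapped₂ : ℕ → ℕ → ℕ → List ℕ
  gapped₂ zero    g h = []
  gapped₂ (suc K) g h with K ≟ g | K ≟ h
  ... | yes _ | _     = gapped₂ K g h
  ... | no  _ | yes _ = gapped₂ K g h
  ... | no  _ | no  _ = K ∷ gapped₂ K g h

  gapped-< : ∀ K g → All (_< K) (gapped K g)
  gapped-< zero    g = []
  gapped-< (suc K) g with K ≟ g
  ... | yes _ = All.map m<n⇒m<1+n (gapped-< K g)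
  ... | no  _ = n<1+n K ∷ All.map m<n⇒m<1+n (gapped-< K g)

  occupied-gapped⁺ : ∀ {K g x} → x < K → x ≢ g → Occupied (gapped K g) x
  occupied-gapped⁺ {suc K} {g} {x} x<1+K x≢g with K ≟ g | x ≟ K
  ... | yes K≡g | yes x≡K = ⊥-elim (x≢g (≡.trans x≡K K≡g))
  ... | yes _   | no  x≢K = occupied-gapped⁺ (≤∧≢⇒< (≤-pred x<1+K) x≢K) x≢g
  ... | no  _   | yes x≡K = here (≡.sym x≡K)
  ... | no  _   | no  x≢K = there (occupied-gapped⁺ (≤∧≢⇒< (≤-pred x<1+K) x≢K) x≢g)

  occupied-gapped⁻ : ∀ {K g x} → Occupied (gapped K g) x → x < K × x ≢ g
  occupied-gapped⁻ {suc K} {g} occ with K ≟ g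
  occupied-gapped⁻ {suc K} {g} occ         | yes _   = map₁ m<n⇒m<1+n (occupied-gapped⁻ occ)
  occupied-gapped⁻ {suc K} {g} (here K≡x)  | no  K≢g =
    ≡.subst (_< suc K) K≡x (n<1+n K) , λ x≡g → K≢g (≡.trans K≡x x≡g)
  occupied-gapped⁻ {suc K} {g} (there occ) | no  _   = map₁ m<n⇒m<1+n (occupied-gapped⁻ occ)

  length-gapped-≤ : ∀ K g → K ≤ g → length (gapped K g) ≡ K
  length-gapped-≤ zero    g _   = ≡.refl
  length-gapped-≤ (suc K) g K<g with K ≟ g
  ... | yes K≡g = ⊥-elim (<-irrefl K≡g K<g)
  ... | no  _   = cong suc (length-gapped-≤ K g (<⇒≤ K<g))

  length-gapped : ∀ L g → g ≤ L → length (gapped (suc L) g) ≡ L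
  length-gapped L g g≤L with L ≟ g
  ... | yes ≡.refl = length-gapped-≤ L L ≤-refl
  length-gapped zero    .zero z≤n   | no 0≢0   = ⊥-elim (0≢0 ≡.refl)
  length-gapped (suc L) g     g≤1+L | no 1+L≢g =
    cong suc (length-gapped L g (≤-pred (≤∧≢⇒< g≤1+L (≢-sym 1+L≢g))))

  gapped₂-≤ : ∀ K g h → K ≤ h → gapped₂ K g h ≡ gapped K g
  gapped₂-≤ zero    g h _   = ≡.refl
  gapped₂-≤ (suc K) g h K<h with K ≟ g | K ≟ h
  ... | yes _ | _       = gapped₂-≤ K g h (<⇒≤ K<h)
  ... | no  _ | yes K≡h = ⊥-elim (<-irrefl K≡h K<h)
  ... | no  _ | no  _   = cong (K ∷_) (gapped₂-≤ K g h (<⇒≤ K<h))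

  gapped₂-comm : ∀ K g h → gapped₂ K g h ≡ gapped₂ K h g
  gapped₂-comm zero    g h = ≡.refl
  gapped₂-comm (suc K) g h with K ≟ g | K ≟ h
  ... | yes _ | yes _ = gapped₂-comm K g h
  ... | yes _ | no  _ = gapped₂-comm K g h
  ... | no  _ | yes _ = gapped₂-comm K g h
  ... | no  _ | no  _ = cong (K ∷_) (gapped₂-comm K g h)

  gapped-↭ : ∀ {K g h} → h < K → h ≢ g → gapped K g ↭ h ∷ gapped₂ K g h
  gapped-↭ {suc K} {g} {h} h<1+K h≢g with K ≟ g | K ≟ h
  ... | yes K≡g | _          =
    gapped-↭ (≤∧≢⇒< (≤-pred h<1+K) (λ h≡K → h≢g (≡.trans h≡K K≡g))) h≢g
  ... | no  _   | yes ≡.refl =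
    prep K (≡.subst (gapped K g ↭_) (≡.sym (gapped₂-≤ K g K ≤-refl)) refl)
  ... | no  _   | no  K≢h    =
    trans (prep K (gapped-↭ (≤∧≢⇒< (≤-pred h<1+K) (≢-sym K≢h)) h≢g)) (swap K h refl)

  lookup-↭ : ∀ (β : List ℕ) i → β ↭ lookup β i ∷ removeAt β i
  lookup-↭ (b ∷ β) Fin.zero    = refl
  lookup-↭ (b ∷ β) (Fin.suc i) = trans (prep b (lookup-↭ β i)) (swap b (lookup β i) refl)

  updateAt-↭ : ∀ (β : List ℕ) i y → updateAt β i (λ _ → y) ↭ y ∷ removeAt β i
  updateAt-↭ (b ∷ β) Fin.zero    y = refl
  updateAt-↭ (b ∷ β) (Fin.suc i) y = trans (prep b (updateAt-↭ β i y)) (swap b y refl)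

  fill-gap : ∀ {L g h} (ℓ : List ℕ) i → ℓ ↭ gapped (suc L) g → lookup ℓ i ≡ h →
             g ≤ L → h ≤ L → h ≢ g → updateAt ℓ i (λ _ → g) ↭ gapped (suc L) h
  fill-gap {L} {g} {h} ℓ i ℓ↭ ℓᵢ≡h g≤L h≤L h≢g = begin
    updateAt ℓ i (λ _ → g)   ↭⟨ updateAt-↭ ℓ i g ⟩
    g ∷ removeAt ℓ i         ↭⟨ prep g rest↭ ⟩
    g ∷ gapped₂ (suc L) g h  ≡⟨ cong (g ∷_) (gapped₂-comm (suc L) g h) ⟩
    g ∷ gapped₂ (suc L) h g  ↭⟨ ↭-sym (gapped-↭ (s≤s g≤L) (≢-sym h≢g)) ⟩
    gapped (suc L) h         ∎
    where
    open PermutationReasoning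
    rest↭ : removeAt ℓ i ↭ gapped₂ (suc L) g h
    rest↭ = drop-∷ (begin
      h ∷ removeAt ℓ i         ≡⟨ cong (_∷ removeAt ℓ i) (≡.sym ℓᵢ≡h) ⟩
      lookup ℓ i ∷ removeAt ℓ i ↭⟨ ↭-sym (lookup-↭ ℓ i) ⟩
      ℓ                        ↭⟨ ℓ↭ ⟩
      gapped (suc L) g         ↭⟨ gapped-↭ (s≤s h≤L) h≢g ⟩
      h ∷ gapped₂ (suc L) g h  ∎)

  beadsBetween : ℕ → ℕ → List ℕ → ℕ
  beadsBetween a b β = length (filter (λ c → a <? c ×-dec c <? b) β)

  beadsBetween-↭ : ∀ a b {β β′} → β ↭ β′ → beadsBetween a b β ≡ beadsBetween a b β′
  beadsBetween-↭ a b β↭β′ = ↭-length (filter-↭ (λ c → a <? c ×-dec c <? b) β↭β′)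

  beadsBetween-gapped-≤ : ∀ K g b → K ≤ b → beadsBetween g b (gapped K g) ≡ K ∸ suc g
  beadsBetween-gapped-≤ zero    g b _   = ≡.refl
  beadsBetween-gapped-≤ (suc K) g b K<b with K ≟ g
  ... | yes ≡.refl =
    ≡.trans (beadsBetween-gapped-≤ K K b (<⇒≤ K<b)) (≡.trans (m≤n⇒m∸n≡0 (n≤1+n K)) (≡.sym (n∸n≡0 K)))
  ... | no  K≢g with g <? K
  ...   | yes g<K rewrite filter-accept (λ c → g <? c ×-dec c <? b) {K} {gapped K g} (g<K , K<b) =
    ≡.trans (cong suc (beadsBetween-gapped-≤ K g b (<⇒≤ K<b))) (≡.sym (+-∸-assoc 1 g<K))
  ...   | no  g≮K rewrite filter-reject (λ c → g <? c ×-dec c <? b) {K} {gapped K g} (g≮K ∘ proj₁) =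
    ≡.trans (beadsBetween-gapped-≤ K g b (<⇒≤ K<b))
            (≡.trans (m≤n⇒m∸n≡0 (m≤n⇒m≤1+n K≤g)) (≡.sym (m≤n⇒m∸n≡0 K≤g)))
    where K≤g = ≮⇒≥ g≮K

  beadsBetween-gapped-≥ : ∀ K g b → b ≤ K → beadsBetween g b (gapped K g) ≡ b ∸ suc g
  beadsBetween-gapped-≥ zero    g .zero z≤n = ≡.refl
  beadsBetween-gapped-≥ (suc K) g b b≤1+K with b ≤? K
  ... | no  b≰K =
    ≡.trans (beadsBetween-gapped-≤ (suc K) g b (≤-reflexive (≡.sym b≡1+K))) (cong (_∸ suc g) (≡.sym b≡1+K))
    where b≡1+K = ≤-antisym b≤1+K (≰⇒> b≰K)
  ... | yes b≤K with K ≟ g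
  ...   | yes ≡.refl = beadsBetween-gapped-≥ K K b b≤K
  ...   | no  _
    rewrite filter-reject (λ c → g <? c ×-dec c <? b) {K} {gapped K g} (λ (_ , K<b) → <⇒≱ K<b b≤K) =
    beadsBetween-gapped-≥ K g b b≤K

  multiplicity : ℕ → List ℕ → ℕ
  multiplicity h β = length (filter (_≟ h) β)

  multiplicity-↭ : ∀ h {β β′} → β ↭ β′ → multiplicity h β ≡ multiplicity h β′
  multiplicity-↭ h β↭β′ = ↭-length (filter-↭ (_≟ h) β↭β′)

  multiplicity-gapped-≤ : ∀ K g h → K ≤ h → multiplicity h (gapped K g) ≡ 0
  multiplicity-gapped-≤ zero    g h _   = ≡.refl
  multiplicity-gapped-≤ (suc K) g h K<h with K ≟ g
  ... | yes _ = multiplicity-gapped-≤ K g h (<⇒≤ K<h)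
  ... | no  _ rewrite filter-reject (_≟ h) {K} {gapped K g} (λ K≡h → <-irrefl K≡h K<h) =
    multiplicity-gapped-≤ K g h (<⇒≤ K<h)

  multiplicity-gapped : ∀ K g h → h < K → h ≢ g → multiplicity h (gapped K g) ≡ 1
  multiplicity-gapped (suc K) g h h<1+K h≢g with K ≟ g
  ... | yes K≡g =
    multiplicity-gapped K g h (≤∧≢⇒< (≤-pred h<1+K) (λ h≡K → h≢g (≡.trans h≡K K≡g))) h≢g
  ... | no  _ with K ≟ h
  ...   | yes K≡h rewrite filter-accept (_≟ h) {K} {gapped K g} K≡h =
    cong suc (multiplicity-gapped-≤ K g h (≤-reflexive K≡h))
  ...   | no  K≢h rewrite filter-reject (_≟ h) {K} {gapped K g} K≢h =
    multiplicity-gapped K g h (≤∧≢⇒< (≤-pred h<1+K) (≢-sym K≢h)) h≢g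


module MurnaghanNakayama where

  open import Data.Nat using (ℕ; zero; suc; _+_; _∸_; _≤_; _<_; s≤s; _≟_; _<?_; _≤?_)
  open import Data.Nat.Properties
  open import Data.Integer as ℤ using (ℤ; 0ℤ)
  import Data.Integer.Properties as ℤ
  open import Data.Bool using (Bool; true; false; if_then_else_; _∧_; not)
  open import Data.List using (List; []; _∷_; length; lookup; updateAt; map; foldr; allFin; tabulate)
  open import Data.List.Properties using (filter-accept; filter-reject; filter-none; map-tabulate; tabulate-cong)
  open import Data.List.Relation.Unary.Any using (Any; here; there; any?)
  import Data.List.Relation.Unary.Any as Any
  open import Data.List.Relation.Unary.All using (All)
  import Data.List.Relation.Unary.All as All
  open import Data.List.Membership.Propositional.Properties using (∈-lookup)
  open import Data.List.Relation.Binary.Permutation.Propositional using (_↭_; ↭-sym)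
  open import Data.List.Relation.Binary.Permutation.Propositional.Properties
    using (Any-resp-↭; All-resp-↭; ↭-length)
  open import Data.Fin using (Fin)
  import Data.Fin as Fin
  open import Data.Product using (_×_; _,_; proj₁; proj₂; map₁)
  open import Data.Empty using (⊥-elim)
  open import Relation.Nullary using (¬_; yes; no; does)
  open import Relation.Nullary.Decidable using (_×-dec_; dec-true; dec-false)
  open import Relation.Binary.PropositionalEquality as ≡ using (_≡_; _≢_; cong; cong₂; ≢-sym)
  open import Defs using (chiβ; sumℤ; signℤ)
  open Abacus

  if-true : ∀ {A : Set} {b} {x y : A} → b ≡ true → (if b then x else y) ≡ x
  if-true ≡.refl = ≡.refl

  if-false : ∀ {A : Set} {b} {x y : A} → b ≡ false → (if b then x else y) ≡ y
  if-false ≡.refl = ≡.refl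

  occupied-lookup : ∀ (β : List ℕ) i → Occupied β (lookup β i)
  occupied-lookup β i = Any.map ≡.sym (∈-lookup i)

  legal : ℕ → List ℕ → ℕ → Bool
  legal r β b = does (r ≤? b) ∧ not (does (any? (λ c → c ≟ (b ∸ r)) β))

  -- A term of `chiβ β (r ∷ μ)`; `place b′` is β with the sliding bead b moved to b′.
  slide : ℕ → List ℕ → List ℕ → ℕ → (ℕ → List ℕ) → ℤ
  slide r μ β b place =
    if legal r β b then signℤ (beadsBetween (b ∸ r) b β) ℤ.* chiβ (place (b ∸ r)) μ else 0ℤ

  moveTerm : ℕ → List ℕ → (β : List ℕ) → Fin (length β) → ℤ
  moveTerm r μ β i = slide r μ β (lookup β i) (λ b′ → updateAt β i (λ _ → b′))

  slide-legal : ∀ {r μ β b} place → r ≤ b → ¬ Occupied β (b ∸ r) →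
    slide r μ β b place ≡ signℤ (beadsBetween (b ∸ r) b β) ℤ.* chiβ (place (b ∸ r)) μ
  slide-legal {r} {μ} {β} {b} place r≤b free
    rewrite dec-true (r ≤? b) r≤b | dec-false (any? (λ c → c ≟ (b ∸ r)) β) free = ≡.refl

  slide-short : ∀ {r μ β b} place → ¬ r ≤ b → slide r μ β b place ≡ 0ℤ
  slide-short {r} {b = b} place r≰b rewrite dec-false (r ≤? b) r≰b = ≡.refl

  slide-blocked : ∀ {r μ β b} place → Occupied β (b ∸ r) → slide r μ β b place ≡ 0ℤ
  slide-blocked {r} {μ} {β} {b} place occ
    rewrite dec-true (any? (λ c → c ≟ (b ∸ r)) β) occ with does (r ≤? b)
  ... | true  = ≡.refl
  ... | false = ≡.refl

  sumℤ-select : ∀ {I X : Set} (F : X → ℤ) (c : I → Bool) (e : I → X) (xs : List I) →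
    sumℤ (map F (foldr (λ i acc → if c i then e i ∷ acc else acc) [] xs))
      ≡ sumℤ (map (λ i → if c i then F (e i) else 0ℤ) xs)
  sumℤ-select F c e []       = ≡.refl
  sumℤ-select F c e (i ∷ xs) with c i
  ... | true  = cong (ℤ._+_ (F (e i))) (sumℤ-select F c e xs)
  ... | false = ≡.trans (sumℤ-select F c e xs) (≡.sym (ℤ.+-identityˡ _))

  chiβ-∷ : ∀ r μ β → chiβ β (r ∷ μ) ≡ sumℤ (tabulate (moveTerm r μ β))
  chiβ-∷ r μ β =
    ≡.trans (sumℤ-select (λ (s , β′) → s ℤ.* chiβ β′ μ) (λ i → legal r β (lookup β i))
               (λ i → signℤ (beadsBetween (lookup β i ∸ r) (lookup β i) β)
                    , updateAt β i (λ _ → lookup β i ∸ r))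
               (allFin (length β)))
            (cong sumℤ (map-tabulate (λ i → i) (moveTerm r μ β)))

  sumℤ-indicator : ∀ (ℓ : List ℕ) h X →
    sumℤ (tabulate (λ i → if does (lookup ℓ i ≟ h) then X else 0ℤ)) ≡ ℤ.+ multiplicity h ℓ ℤ.* X
  sumℤ-indicator []      h X = ≡.refl
  sumℤ-indicator (x ∷ ℓ) h X with x ≟ h
  ... | yes x≡h rewrite filter-accept (_≟ h) {x} {ℓ} x≡h =
    ≡.trans (cong₂ ℤ._+_ (if-true (dec-true (x ≟ h) x≡h)) (sumℤ-indicator ℓ h X))
            (≡.sym (ℤ.suc-* (ℤ.+ multiplicity h ℓ) X))
  ... | no  x≢h rewrite filter-reject (_≟ h) {x} {ℓ} x≢h =
    ≡.trans (cong₂ ℤ._+_ (if-false (dec-false (x ≟ h) x≢h)) (sumℤ-indicator ℓ h X))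
            (ℤ.+-identityˡ _)

  -- N ∷ ℓ is a β-set of the hook (N ∸ L , 1^(L ∸ g)): a head bead N above the beads 0, …, L with a
  -- gap at g.
  record HookAbacus (N L g : ℕ) (ℓ : List ℕ) : Set where
    constructor hookAbacus
    field
      L<N : L < N
      g≤L : g ≤ L
      ℓ↭  : ℓ ↭ gapped (suc L) g

  module _ {N L g ℓ} (H : HookAbacus N L g ℓ) where
    open HookAbacus H

    occupied⁻ : ∀ {x} → Occupied ℓ x → x ≤ L × x ≢ g
    occupied⁻ occ = map₁ ≤-pred (occupied-gapped⁻ (Any-resp-↭ ℓ↭ occ))

    occupied⁺ : ∀ {x} → x ≤ L → x ≢ g → Occupied ℓ x
    occupied⁺ x≤L x≢g = Any-resp-↭ (↭-sym ℓ↭) (occupied-gapped⁺ (s≤s x≤L) x≢g)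

    length-block : length ℓ ≡ L
    length-block = ≡.trans (↭-length ℓ↭) (length-gapped L g g≤L)

    block-≤ : All (_≤ L) ℓ
    block-≤ = All.map ≤-pred (All-resp-↭ (↭-sym ℓ↭) (gapped-< (suc L) g))

    module _ (r : ℕ) (μ : List ℕ) where

      headTerm : ℤ
      headTerm = moveTerm r μ (N ∷ ℓ) Fin.zero

      GapMovedUp : ℤ → Set
      GapMovedUp w = ∀ ℓ′ → ℓ′ ↭ gapped (suc L) (g + r) → chiβ (N ∷ ℓ′) μ ≡ w

      head-out : 1 ≤ r → r ≤ N → L < N ∸ r → headTerm ≡ chiβ ((N ∸ r) ∷ ℓ) μ
      head-out 1≤r r≤N L<N∸r =
        ≡.trans (slide-legal {r} {μ} {N ∷ ℓ} {N} (_∷ ℓ) r≤N free) sign≡1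
        where
        N∸r<N : N ∸ r < N
        N∸r<N = ∸-monoʳ-< 1≤r r≤N
        free : ¬ Occupied (N ∷ ℓ) (N ∸ r)
        free (here N≡N∸r) = <-irrefl (≡.sym N≡N∸r) N∸r<N
        free (there occ)  = <⇒≱ L<N∸r (proj₁ (occupied⁻ occ))
        sign≡1 : signℤ (beadsBetween (N ∸ r) N (N ∷ ℓ)) ℤ.* chiβ ((N ∸ r) ∷ ℓ) μ ≡ chiβ ((N ∸ r) ∷ ℓ) μ
        sign≡1 rewrite filter-reject (λ c → N ∸ r <? c ×-dec c <? N) {N} {ℓ}
                                     (λ (_ , N<N) → <-irrefl ≡.refl N<N)
                     | filter-none (λ c → N ∸ r <? c ×-dec c <? N) {ℓ}
                         (All.map (λ c≤L (N∸r<c , _) → <⇒≱ N∸r<c (≤-trans c≤L (<⇒≤ L<N∸r))) block-≤)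
          = ℤ.*-identityˡ _

      head-into-gap : r ≤ N → N ∸ r ≡ g → headTerm ≡ signℤ (L ∸ g) ℤ.* chiβ (g ∷ ℓ) μ
      head-into-gap r≤N N∸r≡g =
        ≡.trans (slide-legal {r} {μ} {N ∷ ℓ} {N} (_∷ ℓ) r≤N free) sign≡
        where
        free : ¬ Occupied (N ∷ ℓ) (N ∸ r)
        free (here N≡N∸r) = <-irrefl (≡.sym (≡.trans N≡N∸r N∸r≡g)) (≤-<-trans g≤L L<N)
        free (there occ)  = proj₂ (occupied⁻ occ) N∸r≡g
        sign≡ : signℤ (beadsBetween (N ∸ r) N (N ∷ ℓ)) ℤ.* chiβ ((N ∸ r) ∷ ℓ) μ
                  ≡ signℤ (L ∸ g) ℤ.* chiβ (g ∷ ℓ) μ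
        sign≡ rewrite N∸r≡g
                    | filter-reject (λ c → g <? c ×-dec c <? N) {N} {ℓ} (λ (_ , N<N) → <-irrefl ≡.refl N<N)
                    | beadsBetween-↭ g N ℓ↭
                    | beadsBetween-gapped-≤ (suc L) g N L<N = ≡.refl

      head-blocked : N ∸ r ≤ L → N ∸ r ≢ g → headTerm ≡ 0ℤ
      head-blocked N∸r≤L N∸r≢g =
        slide-blocked {r} {μ} {N ∷ ℓ} {N} (_∷ ℓ) (there (occupied⁺ N∸r≤L N∸r≢g))

      -- Inside the block the only legal slide takes bead g + r into the gap, across r − 1 beads.
      block-term : 1 ≤ r → ∀ w → (g + r ≤ L → GapMovedUp w) → ∀ i →
        moveTerm r μ (N ∷ ℓ) (Fin.suc i) ≡ (if does (lookup ℓ i ≟ g + r) then signℤ (r ∸ 1) ℤ.* w else 0ℤ)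
      block-term 1≤r w filled i with lookup ℓ i ≟ g + r
      ... | yes ℓᵢ≡g+r = begin
        slide r μ (N ∷ ℓ) (lookup ℓ i) place
          ≡⟨ cong (λ b → slide r μ (N ∷ ℓ) b place) ℓᵢ≡g+r ⟩
        slide r μ (N ∷ ℓ) (g + r) place
          ≡⟨ slide-legal {r} {μ} {N ∷ ℓ} {g + r} place (m≤n+m r g) free ⟩
        signℤ (beadsBetween (g + r ∸ r) (g + r) (N ∷ ℓ)) ℤ.* chiβ (place (g + r ∸ r)) μ
          ≡⟨ cong (λ a → signℤ (beadsBetween a (g + r) (N ∷ ℓ)) ℤ.* chiβ (place a) μ) (m+n∸n≡m g r) ⟩
        signℤ (beadsBetween g (g + r) (N ∷ ℓ)) ℤ.* chiβ (N ∷ updateAt ℓ i (λ _ → g)) μ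
          ≡⟨ cong₂ (λ k x → signℤ k ℤ.* x) legs
                   (filled g+r≤L _ (fill-gap ℓ i ℓ↭ ℓᵢ≡g+r g≤L g+r≤L g+r≢g)) ⟩
        signℤ (r ∸ 1) ℤ.* w
          ≡⟨ ≡.sym (if-true (dec-true (lookup ℓ i ≟ g + r) ℓᵢ≡g+r)) ⟩
        (if does (lookup ℓ i ≟ g + r) then signℤ (r ∸ 1) ℤ.* w else 0ℤ) ∎
        where
        open ≡.≡-Reasoning
        place : ℕ → List ℕ
        place b′ = N ∷ updateAt ℓ i (λ _ → b′)
        g+r≤L : g + r ≤ L
        g+r≤L = ≡.subst (_≤ L) ℓᵢ≡g+r (proj₁ (occupied⁻ (occupied-lookup ℓ i)))
        g+r≢g : g + r ≢ g
        g+r≢g = ≢-sym (<⇒≢ (m<m+n g 1≤r))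
        free : ¬ Occupied (N ∷ ℓ) (g + r ∸ r)
        free (here N≡g) = <-irrefl (≡.sym (≡.trans N≡g (m+n∸n≡m g r))) (≤-<-trans g≤L L<N)
        free (there occ) = proj₂ (occupied⁻ occ) (m+n∸n≡m g r)
        legs : beadsBetween g (g + r) (N ∷ ℓ) ≡ r ∸ 1
        legs rewrite filter-reject (λ c → g <? c ×-dec c <? g + r) {N} {ℓ}
                       (λ (_ , N<g+r) → <⇒≱ N<g+r (≤-trans g+r≤L (<⇒≤ L<N)))
                   | beadsBetween-↭ g (g + r) ℓ↭
                   | beadsBetween-gapped-≥ (suc L) g (g + r) (m≤n⇒m≤1+n g+r≤L) = [g+r]∸[1+g] g
          where
          [g+r]∸[1+g] : ∀ g → g + r ∸ suc g ≡ r ∸ 1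
          [g+r]∸[1+g] zero    = ≡.refl
          [g+r]∸[1+g] (suc g) = [g+r]∸[1+g] g
      ... | no ℓᵢ≢g+r =
        ≡.trans vanishes (≡.sym (if-false (dec-false (lookup ℓ i ≟ g + r) ℓᵢ≢g+r)))
        where
        place : ℕ → List ℕ
        place b′ = N ∷ updateAt ℓ i (λ _ → b′)
        vanishes : slide r μ (N ∷ ℓ) (lookup ℓ i) place ≡ 0ℤ
        vanishes with r ≤? lookup ℓ i
        ... | no  r≰ℓᵢ = slide-short {r} {μ} {N ∷ ℓ} place r≰ℓᵢ
        ... | yes r≤ℓᵢ = slide-blocked {r} {μ} {N ∷ ℓ} place (there (occupied⁺ ℓᵢ∸r≤L ℓᵢ∸r≢g))
          where
          ℓᵢ∸r≤L : lookup ℓ i ∸ r ≤ L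
          ℓᵢ∸r≤L = ≤-trans (m∸n≤m (lookup ℓ i) r) (proj₁ (occupied⁻ (occupied-lookup ℓ i)))
          ℓᵢ∸r≢g : lookup ℓ i ∸ r ≢ g
          ℓᵢ∸r≢g ℓᵢ∸r≡g =
            ℓᵢ≢g+r (≡.trans (≡.sym (m∸n+n≡m r≤ℓᵢ)) (cong (_+ r) ℓᵢ∸r≡g))

      block-sum : 1 ≤ r → ∀ w → (g + r ≤ L → GapMovedUp w) →
        sumℤ (tabulate (λ i → moveTerm r μ (N ∷ ℓ) (Fin.suc i)))
          ≡ ℤ.+ multiplicity (g + r) (gapped (suc L) g) ℤ.* (signℤ (r ∸ 1) ℤ.* w)
      block-sum 1≤r w filled =
        ≡.trans (cong sumℤ (tabulate-cong (block-term 1≤r w filled)))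
          (≡.trans (sumℤ-indicator ℓ (g + r) (signℤ (r ∸ 1) ℤ.* w))
                   (cong (λ m → ℤ.+ m ℤ.* (signℤ (r ∸ 1) ℤ.* w)) (multiplicity-↭ (g + r) ℓ↭)))

      step-fill : 1 ≤ r → g + r ≤ L → ∀ w → GapMovedUp w →
        chiβ (N ∷ ℓ) (r ∷ μ) ≡ headTerm ℤ.+ signℤ (r ∸ 1) ℤ.* w
      step-fill 1≤r g+r≤L w filled =
        ≡.trans (chiβ-∷ r μ (N ∷ ℓ))
          (cong (ℤ._+_ headTerm)
            (≡.trans (block-sum 1≤r w (λ _ → filled))
              (≡.trans (cong (λ m → ℤ.+ m ℤ.* (signℤ (r ∸ 1) ℤ.* w))
                             (multiplicity-gapped (suc L) g (g + r) (s≤s g+r≤L) g+r≢g))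
                       (ℤ.*-identityˡ _))))
        where
        g+r≢g : g + r ≢ g
        g+r≢g = ≢-sym (<⇒≢ (m<m+n g 1≤r))

      step-head : 1 ≤ r → L < g + r → chiβ (N ∷ ℓ) (r ∷ μ) ≡ headTerm
      step-head 1≤r L<g+r =
        ≡.trans (chiβ-∷ r μ (N ∷ ℓ))
          (≡.trans (cong (ℤ._+_ headTerm)
            (≡.trans (block-sum 1≤r 0ℤ (λ g+r≤L → ⊥-elim (<⇒≱ L<g+r g+r≤L)))
                     (cong (λ m → ℤ.+ m ℤ.* (signℤ (r ∸ 1) ℤ.* 0ℤ))
                           (multiplicity-gapped-≤ (suc L) g (g + r) L<g+r))))
            (ℤ.+-identityʳ _))


module HookCharacter where

  open import Data.Nat using (ℕ; zero; suc; _+_; _∸_; _≤_; _<_; z≤n; s≤s; _<?_; _≤?_)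
  open import Data.Nat.Properties
  open import Data.Nat.ListAction using (sum)
  open import Data.Nat.ListAction.Properties using (sum-++)
  open import Data.Integer as ℤ using (ℤ; 0ℤ; 1ℤ)
  import Data.Integer.Properties as ℤ
  open import Data.List using (List; []; _∷_; _++_; [_]; length; replicate; zipWith; downFrom)
  open import Data.List.Properties using (length-replicate; ++-assoc)
  import Data.List.Relation.Unary.All.Properties as All
  open import Data.List.Relation.Binary.Permutation.Propositional using (↭-refl)
  open import Data.List.Relation.Unary.All using (All; []; _∷_; all?)
  import Data.List.Relation.Unary.All as All
  open import Relation.Nullary using (yes; no)
  open import Relation.Nullary.Decidable using (dec-true)
  open import Relation.Binary.PropositionalEquality as ≡ using (_≡_; _≢_; cong; cong₂)
  open import Data.Nat.Tactic.RingSolver using (solve-∀)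
  open import Defs using (chiβ; signℤ; χ; betaSet; hook; pad)
  open Binomial
  open Series
  open Abacus
  open MurnaghanNakayama

  module _ {N L g ℓ} (H : HookAbacus N L g ℓ) where
    open HookAbacus H

    full-block-empty : chiβ (g ∷ ℓ) [] ≡ 1ℤ
    full-block-empty = if-true (dec-true (all? (λ c → c <? length (g ∷ ℓ)) (g ∷ ℓ)) all<)
      where
      all< : All (_< length (g ∷ ℓ)) (g ∷ ℓ)
      all< rewrite length-block H = s≤s g≤L ∷ All.map s≤s (block-≤ H)

  -- The final part 1 is what drops the head bead into the gap and ends the recursion; it is why the
  -- product has one factor 1 + x fewer than there are parts 1.
  chiβ-hook : ∀ μ → All (1 ≤_) μ → ∀ {N L g ℓ} → HookAbacus N L g ℓ → N ≡ g + suc (sum μ) →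
    chiβ (N ∷ ℓ) (μ ++ [ 1 ]) ≡ cycleProduct μ (binomial 0) (L ∸ g)
  chiβ-hook [] [] {N} {L} {g} {ℓ} H@(hookAbacus L<N g≤L _) N≡g+1 = begin
    chiβ (N ∷ ℓ) [ 1 ]
      ≡⟨ step-head H 1 [] (s≤s z≤n) L<g+1 ⟩
    headTerm H 1 []
      ≡⟨ head-into-gap H 1 [] (≤-trans (s≤s z≤n) L<N) N∸1≡g ⟩
    signℤ (L ∸ g) ℤ.* chiβ (g ∷ ℓ) []
      ≡⟨ cong₂ (λ k x → signℤ k ℤ.* x) (m≤n⇒m∸n≡0 L≤g) (full-block-empty H) ⟩
    1ℤ
      ≡⟨ cong (binomial 0) (≡.sym (m≤n⇒m∸n≡0 L≤g)) ⟩
    binomial 0 (L ∸ g) ∎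
    where
    open ≡.≡-Reasoning
    L<g+1 : L < g + 1
    L<g+1 = ≡.subst (L <_) N≡g+1 L<N
    L≤g : L ≤ g
    L≤g = ≤-pred (≡.subst (L <_) (+-comm g 1) L<g+1)
    N∸1≡g : N ∸ 1 ≡ g
    N∸1≡g = ≡.trans (cong (_∸ 1) N≡g+1) (m+n∸n≡m g 1)
  chiβ-hook (r ∷ μ) (1≤r ∷ 1≤μ) {N} {L} {g} {ℓ} H@(hookAbacus L<N g≤L ℓ↭) N≡ = begin
    chiβ (N ∷ ℓ) (r ∷ ρ)
      ≡⟨ head+block ⟩
    head ℤ.+ ε ℤ.* shift r Y (L ∸ g)
      ≡⟨ cong (ℤ._+ ε ℤ.* shift r Y (L ∸ g)) head-value ⟩
    Y (L ∸ g) ℤ.+ ε ℤ.* shift r Y (L ∸ g) ∎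
    where
    open ≡.≡-Reasoning
    ρ = μ ++ [ 1 ]
    ε = signℤ (r ∸ 1)
    Y = cycleProduct μ (binomial 0)
    head = headTerm H r ρ

    ≤-∸ : ∀ {x} → g + x ≤ L → x ≤ L ∸ g
    ≤-∸ {x} g+x≤L = ≡.subst (_≤ L ∸ g) (m+n∸m≡n g x) (∸-monoˡ-≤ g g+x≤L)
    N≡[g+r]+ : N ≡ g + r + suc (sum μ)
    N≡[g+r]+ = ≡.trans N≡ (shuffle g r (sum μ))
      where
      shuffle : ∀ g r s → g + suc (r + s) ≡ g + r + suc s
      shuffle = solve-∀
    N∸r≡ : N ∸ r ≡ g + suc (sum μ)
    N∸r≡ = ≡.trans (cong (_∸ r) (≡.trans N≡ (shuffle g r (sum μ)))) (m+n∸n≡m _ r)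
      where
      shuffle : ∀ g r s → g + suc (r + s) ≡ g + suc s + r
      shuffle = solve-∀

    head-value : head ≡ Y (L ∸ g)
    head-value with L <? N ∸ r
    ... | yes L<N∸r =
      ≡.trans (head-out H r ρ 1≤r r≤N L<N∸r) (chiβ-hook μ 1≤μ (hookAbacus L<N∸r g≤L ℓ↭) N∸r≡)
      where
      r≤N : r ≤ N
      r≤N = ≡.subst (r ≤_) (≡.sym N≡[g+r]+) (≤-trans (m≤n+m r g) (m≤m+n (g + r) _))
    ... | no  L≮N∸r =
      ≡.trans (head-blocked H r ρ N∸r≤L (λ N∸r≡g → m+1+n≢m g (≡.trans (≡.sym N∸r≡) N∸r≡g)))
              (≡.sym (cycleProduct-vanishes μ δ-vanishes (L ∸ g) beyond))
      where
      N∸r≤L : N ∸ r ≤ L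
      N∸r≤L = ≮⇒≥ L≮N∸r
      beyond : sum μ + 1 ≤ L ∸ g
      beyond = ≡.subst (_≤ L ∸ g) (+-comm 1 (sum μ)) (≤-∸ (≡.subst (_≤ L) N∸r≡ N∸r≤L))
      δ-vanishes : VanishesFrom 1 (binomial 0)
      δ-vanishes (suc l) _ = ≡.refl

    head+block : chiβ (N ∷ ℓ) (r ∷ ρ) ≡ head ℤ.+ ε ℤ.* shift r Y (L ∸ g)
    head+block with g + r ≤? L
    ... | yes g+r≤L = begin
      chiβ (N ∷ ℓ) (r ∷ ρ)
        ≡⟨ step-fill H r ρ 1≤r g+r≤L (Y (L ∸ (g + r)))
                     (λ ℓ′ ℓ′↭ → chiβ-hook μ 1≤μ (hookAbacus L<N g+r≤L ℓ′↭) N≡[g+r]+) ⟩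
      head ℤ.+ ε ℤ.* Y (L ∸ (g + r))
        ≡⟨ cong (λ y → head ℤ.+ ε ℤ.* y)
                (≡.sym (≡.trans (shift-≥ Y (≤-∸ g+r≤L)) (cong Y (∸-+-assoc L g r)))) ⟩
      head ℤ.+ ε ℤ.* shift r Y (L ∸ g) ∎
    ... | no  g+r≰L = begin
      chiβ (N ∷ ℓ) (r ∷ ρ)                ≡⟨ step-head H r ρ 1≤r L<g+r ⟩
      head                                ≡⟨ ≡.sym (ℤ.+-identityʳ head) ⟩
      head ℤ.+ 0ℤ                         ≡⟨ cong (ℤ._+_ head) (≡.sym (ℤ.*-zeroʳ ε)) ⟩
      head ℤ.+ ε ℤ.* 0ℤ                   ≡⟨ cong (λ y → head ℤ.+ ε ℤ.* y) (≡.sym (shift-< Y L∸g<r)) ⟩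
      head ℤ.+ ε ℤ.* shift r Y (L ∸ g)    ∎
      where
      L<g+r : L < g + r
      L<g+r = ≰⇒> g+r≰L
      L∸g<r : L ∸ g < r
      L∸g<r = ≡.subst (L ∸ g <_) (m+n∸m≡n g r) (∸-monoˡ-< L<g+r g≤L)

  betaSet-hook : ∀ n j → j ≤ n → betaSet (hook n j) ≡ n ∷ gapped (suc (n ∸ j)) 0
  betaSet-hook n j j≤n rewrite length-replicate (n ∸ j) {1} | m+[n∸m]≡n j≤n =
    cong (n ∷_) (staircase (n ∸ j))
    where
    staircase : ∀ L → zipWith _+_ (replicate L 1) (downFrom L) ≡ gapped (suc L) 0
    staircase zero    = ≡.refl
    staircase (suc L) = cong (suc L ∷_) (staircase L)

  replicate-suc : ∀ m (x : ℕ) → replicate (suc m) x ≡ replicate m x ++ [ x ]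
  replicate-suc zero    x = ≡.refl
  replicate-suc (suc m) x = cong (x ∷_) (replicate-suc m x)

  sum-replicate-1 : ∀ m → sum (replicate m 1) ≡ m
  sum-replicate-1 zero    = ≡.refl
  sum-replicate-1 (suc m) = cong suc (sum-replicate-1 m)

  χ-hook : ∀ μ₀ → All (1 ≤_) μ₀ → ∀ M {i} → let n = suc (sum μ₀ + M) in i < n →
    χ (hook n (suc i)) (pad μ₀ n) ≡ cycleProduct μ₀ (binomial M) (n ∸ suc i)
  χ-hook μ₀ 1≤μ₀ M {i} i<n = begin
    chiβ (betaSet (hook n (suc i))) (μ₀ ++ replicate (n ∸ sum μ₀) 1)
      ≡⟨ cong₂ chiβ (betaSet-hook n (suc i) i<n) parts ⟩
    chiβ (n ∷ gapped (suc (n ∸ suc i)) 0) ((μ₀ ++ replicate M 1) ++ [ 1 ])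
      ≡⟨ chiβ-hook (μ₀ ++ replicate M 1) (All.++⁺ 1≤μ₀ (All.replicate⁺ M (s≤s z≤n))) H size ⟩
    cycleProduct (μ₀ ++ replicate M 1) (binomial 0) (n ∸ suc i)
      ≡⟨ cycleProduct-++ μ₀ (replicate M 1) (binomial 0) (n ∸ suc i) ⟩
    cycleProduct μ₀ (cycleProduct (replicate M 1) (binomial 0)) (n ∸ suc i)
      ≡⟨ cycleProduct-cong μ₀ (cycleProduct-ones M) (n ∸ suc i) ⟩
    cycleProduct μ₀ (binomial M) (n ∸ suc i) ∎
    where
    open ≡.≡-Reasoning
    n = suc (sum μ₀ + M)
    H : HookAbacus n (n ∸ suc i) 0 (gapped (suc (n ∸ suc i)) 0)
    H = hookAbacus (∸-monoʳ-< (s≤s z≤n) i<n) z≤n ↭-refl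
    n∸s≡1+M : n ∸ sum μ₀ ≡ suc M
    n∸s≡1+M = ≡.trans (cong (_∸ sum μ₀) (≡.sym (+-suc (sum μ₀) M))) (m+n∸m≡n (sum μ₀) (suc M))
    parts : μ₀ ++ replicate (n ∸ sum μ₀) 1 ≡ (μ₀ ++ replicate M 1) ++ [ 1 ]
    parts = begin
      μ₀ ++ replicate (n ∸ sum μ₀) 1   ≡⟨ cong (λ k → μ₀ ++ replicate k 1) n∸s≡1+M ⟩
      μ₀ ++ replicate (suc M) 1        ≡⟨ cong (μ₀ ++_) (replicate-suc M 1) ⟩
      μ₀ ++ (replicate M 1 ++ [ 1 ])   ≡⟨ ≡.sym (++-assoc μ₀ (replicate M 1) [ 1 ]) ⟩
      (μ₀ ++ replicate M 1) ++ [ 1 ]   ∎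
    size : n ≡ 0 + suc (sum (μ₀ ++ replicate M 1))
    size = cong suc (≡.sym (≡.trans (sum-++ μ₀ (replicate M 1)) (cong (sum μ₀ +_) (sum-replicate-1 M))))


module HookSquareSum where

  open import Data.Nat using (ℕ; suc; _∸_; _≤_; _<_; ∣_-_∣)
  import Data.Nat as ℕ
  import Data.Nat.Properties as ℕ
  open import Data.Nat.ListAction using (sum)
  open import Data.Integer using (ℤ; _+_; _*_)
  open import Data.Integer.Tactic.RingSolver using (solve-∀)
  open import Data.List using (List)
  open import Data.List.Relation.Unary.All using (All)
  open import Data.Product using (_×_; _,_)
  open import Relation.Binary.PropositionalEquality using (_≡_; trans; cong; cong₂; module ≡-Reasoning)
  open ≡-Reasoning
  open import Defs using (φ2; χ; hook; pad)
  open Sums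
  open Binomial
  open Series
  open HookCharacter

  φ2-expansion : ∀ μ₀ → All (1 ≤_) μ₀ → ∀ M →
    φ2 μ₀ (suc (sum μ₀ ℕ.+ M))
      ≡ ∑[ (c , d) ∈ monomials μ₀ ] ∑[ (c′ , d′) ∈ monomials μ₀ ]
          (c * c′ * binomial (M ℕ.+ M) (M ℕ.+ ∣ d - d′ ∣))
  φ2-expansion μ₀ 1≤μ₀ M = begin
    φ2 μ₀ n
      ≡⟨ sumℤ-applyUpTo n (λ i → χᵢ i * χᵢ i) ⟩
    ∑[ i < n ] (χᵢ i * χᵢ i)
      ≡⟨ ∑<-cong n (λ i i<n → cong₂ _*_ (χ-hook μ₀ 1≤μ₀ M i<n) (χ-hook μ₀ 1≤μ₀ M i<n)) ⟩
    ∑[ i < n ] (Y (n ∸ suc i) * Y (n ∸ suc i))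
      ≡⟨ ∑<-reverse n (λ l → Y l * Y l) ⟩
    ∑[ l < n ] (Y l * Y l)
      ≡⟨ ∑<-cong n (λ l _ → trans (cong₂ _*_ (cycleProduct-expand μ₀ B l) (cycleProduct-expand μ₀ B l))
                                  (∑∈-product T T (term l) (term l))) ⟩
    ∑[ l < n ] ∑[ t ∈ T ] ∑[ u ∈ T ] (term l t * term l u)
      ≡⟨ ∑<-∑∈-comm n T (λ l t → ∑[ u ∈ T ] (term l t * term l u)) ⟩
    ∑[ t ∈ T ] ∑[ l < n ] ∑[ u ∈ T ] (term l t * term l u)
      ≡⟨ ∑∈-cong T (λ t → ∑<-∑∈-comm n T (λ l u → term l t * term l u)) ⟩
    ∑[ t ∈ T ] ∑[ u ∈ T ] ∑[ l < n ] (term l t * term l u)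
      ≡⟨ ∑∈-congᴬ (monomials-degree μ₀) (λ t d≤s →
           ∑∈-congᴬ (monomials-degree μ₀) (λ u d′≤s → pair t u d≤s d′≤s)) ⟩
    ∑[ (c , d) ∈ T ] ∑[ (c′ , d′) ∈ T ] (c * c′ * binomial (M ℕ.+ M) (M ℕ.+ ∣ d - d′ ∣)) ∎
    where
    n = suc (sum μ₀ ℕ.+ M)
    B = binomial M
    χᵢ : ℕ → ℤ
    χᵢ i = χ (hook n (suc i)) (pad μ₀ n)
    Y = cycleProduct μ₀ B
    T = monomials μ₀
    term : ℕ → ℤ × ℕ → ℤ
    term l (c , d) = c * shift d B l
    pair : ∀ (t u : ℤ × ℕ) → let (c , d) = t; (c′ , d′) = u in d ≤ sum μ₀ → d′ ≤ sum μ₀ →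
      ∑[ l < n ] (term l t * term l u) ≡ c * c′ * binomial (M ℕ.+ M) (M ℕ.+ ∣ d - d′ ∣)
    pair (c , d) (c′ , d′) d≤s d′≤s = begin
      ∑[ l < n ] (c * shift d B l * (c′ * shift d′ B l))
        ≡⟨ ∑<-cong n (λ l _ → interchange c c′ (shift d B l) (shift d′ B l)) ⟩
      ∑[ l < n ] (c * c′ * (shift d B l * shift d′ B l))
        ≡⟨ ∑<-*ˡ n (c * c′) (λ l → shift d B l * shift d′ B l) ⟩
      c * c′ * ∑[ l < n ] (shift d B l * shift d′ B l)
        ≡⟨ cong (c * c′ *_) (correlation M ℕ.≤-refl d≤s d′≤s) ⟩
      c * c′ * binomial (M ℕ.+ M) (M ℕ.+ ∣ d - d′ ∣) ∎
      where
      interchange : ∀ a b x y → a * x * (b * y) ≡ a * b * (x * y)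
      interchange = solve-∀


module Polynomial where

  open import Data.Nat using (ℕ; zero; suc)
  open import Data.Integer using (ℤ; +_; 0ℤ; 1ℤ; _+_; _*_)
  import Data.Integer as ℤ
  open import Data.Integer.Properties
  open import Data.Integer.Tactic.RingSolver using (solve-∀)
  open import Data.Rational as ℚ using (ℚ; mkℚ; 0ℚ)
  import Data.Rational.Properties as ℚ
  open import Data.Nat.Coprimality using (1-coprimeTo; sym)
  open import Data.List using (List; []; _∷_; map)
  open import Relation.Binary.PropositionalEquality
    using (_≡_; _≢_; refl; trans; cong; cong₂; module ≡-Reasoning)
  import Relation.Binary.PropositionalEquality as ≡
  open import Defs using (evalPoly; ℤ→ℚ)
  open Sums
  open Binomial using (rising)

  ⟦_⟧ : List ℤ → ℤ → ℤ
  ⟦ []    ⟧ x = 0ℤ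
  ⟦ a ∷ p ⟧ x = a + x * ⟦ p ⟧ x

  infixl 6 _+ₚ_
  infixl 7 _*ₚ_ _·ₚ_
  infixr 6 _+ᶜ_

  _+ₚ_ : List ℤ → List ℤ → List ℤ
  []      +ₚ q       = q
  (a ∷ p) +ₚ []      = a ∷ p
  (a ∷ p) +ₚ (b ∷ q) = a + b ∷ p +ₚ q

  _·ₚ_ : ℤ → List ℤ → List ℤ
  c ·ₚ p = map (c *_) p

  _*ₚ_ : List ℤ → List ℤ → List ℤ
  []      *ₚ q = []
  (a ∷ p) *ₚ q = a ·ₚ q +ₚ (0ℤ ∷ p *ₚ q)

  _+ᶜ_ : ℤ → List ℤ → List ℤ
  c +ᶜ []      = c ∷ []
  c +ᶜ (a ∷ p) = c + a ∷ p

  ⟦+ₚ⟧ : ∀ p q x → ⟦ p +ₚ q ⟧ x ≡ ⟦ p ⟧ x + ⟦ q ⟧ x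
  ⟦+ₚ⟧ []      q       x = ≡.sym (+-identityˡ _)
  ⟦+ₚ⟧ (a ∷ p) []      x = ≡.sym (+-identityʳ _)
  ⟦+ₚ⟧ (a ∷ p) (b ∷ q) x =
    trans (cong (λ y → a + b + x * y) (⟦+ₚ⟧ p q x)) (regroup a b x (⟦ p ⟧ x) (⟦ q ⟧ x))
    where
    regroup : ∀ a b x u v → a + b + x * (u + v) ≡ a + x * u + (b + x * v)
    regroup = solve-∀

  ⟦·ₚ⟧ : ∀ c p x → ⟦ c ·ₚ p ⟧ x ≡ c * ⟦ p ⟧ x
  ⟦·ₚ⟧ c []      x = ≡.sym (*-zeroʳ c)
  ⟦·ₚ⟧ c (a ∷ p) x =
    trans (cong (λ y → c * a + x * y) (⟦·ₚ⟧ c p x)) (distribute c a x (⟦ p ⟧ x))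
    where
    distribute : ∀ c a x u → c * a + x * (c * u) ≡ c * (a + x * u)
    distribute = solve-∀

  ⟦*ₚ⟧ : ∀ p q x → ⟦ p *ₚ q ⟧ x ≡ ⟦ p ⟧ x * ⟦ q ⟧ x
  ⟦*ₚ⟧ []      q x = ≡.sym (*-zeroˡ (⟦ q ⟧ x))
  ⟦*ₚ⟧ (a ∷ p) q x = begin
    ⟦ a ·ₚ q +ₚ (0ℤ ∷ p *ₚ q) ⟧ x
      ≡⟨ ⟦+ₚ⟧ (a ·ₚ q) (0ℤ ∷ p *ₚ q) x ⟩
    ⟦ a ·ₚ q ⟧ x + (0ℤ + x * ⟦ p *ₚ q ⟧ x)
      ≡⟨ cong₂ (λ u v → u + (0ℤ + x * v)) (⟦·ₚ⟧ a q x) (⟦*ₚ⟧ p q x) ⟩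
    a * ⟦ q ⟧ x + (0ℤ + x * (⟦ p ⟧ x * ⟦ q ⟧ x))
      ≡⟨ distribute a x (⟦ p ⟧ x) (⟦ q ⟧ x) ⟩
    (a + x * ⟦ p ⟧ x) * ⟦ q ⟧ x ∎
    where
    open ≡-Reasoning
    distribute : ∀ a x u v → a * v + (0ℤ + x * (u * v)) ≡ (a + x * u) * v
    distribute = solve-∀

  ⟦+ᶜ⟧ : ∀ c p x → ⟦ c +ᶜ p ⟧ x ≡ c + ⟦ p ⟧ x
  ⟦+ᶜ⟧ c []      x = cong (_+_ c) (*-zeroʳ x)
  ⟦+ᶜ⟧ c (a ∷ p) x = +-assoc c a (x * ⟦ p ⟧ x)

  ∑ₚ : {A : Set} → List A → (A → List ℤ) → List ℤ
  ∑ₚ []       f = []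
  ∑ₚ (t ∷ ts) f = f t +ₚ ∑ₚ ts f

  ⟦∑ₚ⟧ : ∀ {A : Set} (ts : List A) f x → ⟦ ∑ₚ ts f ⟧ x ≡ ∑[ t ∈ ts ] ⟦ f t ⟧ x
  ⟦∑ₚ⟧ []       f x = refl
  ⟦∑ₚ⟧ (t ∷ ts) f x = trans (⟦+ₚ⟧ (f t) (∑ₚ ts f) x) (cong (_+_ (⟦ f t ⟧ x)) (⟦∑ₚ⟧ ts f x))

  risingₚ : List ℤ → ℕ → List ℤ
  risingₚ p zero    = 1ℤ ∷ []
  risingₚ p (suc u) = risingₚ p u *ₚ ((+ suc u) +ᶜ p)

  ⟦risingₚ⟧ : ∀ p u x → ⟦ risingₚ p u ⟧ x ≡ rising (⟦ p ⟧ x) u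
  ⟦risingₚ⟧ p zero    x = cong (_+_ 1ℤ) (*-zeroʳ x)
  ⟦risingₚ⟧ p (suc u) x =
    trans (⟦*ₚ⟧ (risingₚ p u) ((+ suc u) +ᶜ p) x)
          (cong₂ _*_ (⟦risingₚ⟧ p u x) (⟦+ᶜ⟧ (+ suc u) p x))

  -- ℤ→ℚ z is z / 1, whose normal form mkℚ z 0 _ makes the ring operations compute.
  ℤ→ℚ≡mkℚ : ∀ z → ℤ→ℚ z ≡ mkℚ z 0 (sym (1-coprimeTo ℤ.∣ z ∣))
  ℤ→ℚ≡mkℚ z = ℚ.↥p/↧p≡p (mkℚ z 0 (sym (1-coprimeTo ℤ.∣ z ∣)))

  ℤ→ℚ-+ : ∀ a b → ℤ→ℚ (a + b) ≡ ℤ→ℚ a ℚ.+ ℤ→ℚ b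
  ℤ→ℚ-+ a b rewrite ℤ→ℚ≡mkℚ a | ℤ→ℚ≡mkℚ b =
    cong (ℚ._/ 1) (cong₂ _+_ (≡.sym (*-identityʳ a)) (≡.sym (*-identityʳ b)))

  ℤ→ℚ-* : ∀ a b → ℤ→ℚ (a * b) ≡ ℤ→ℚ a ℚ.* ℤ→ℚ b
  ℤ→ℚ-* a b rewrite ℤ→ℚ≡mkℚ a | ℤ→ℚ≡mkℚ b = refl

  ℤ→ℚ-injective-0 : ∀ z → ℤ→ℚ z ≡ 0ℚ → z ≡ 0ℤ
  ℤ→ℚ-injective-0 z eq = trans (≡.sym (cong ℚ.↥_ (ℤ→ℚ≡mkℚ z))) (cong ℚ.↥_ eq)

  evalPoly-ℤ→ℚ : ∀ p x → evalPoly (map ℤ→ℚ p) (ℤ→ℚ x) ≡ ℤ→ℚ (⟦ p ⟧ x)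
  evalPoly-ℤ→ℚ []      x = refl
  evalPoly-ℤ→ℚ (a ∷ p) x rewrite evalPoly-ℤ→ℚ p x =
    ≡.sym (trans (ℤ→ℚ-+ a (x * ⟦ p ⟧ x)) (cong (ℤ→ℚ a ℚ.+_) (ℤ→ℚ-* x (⟦ p ⟧ x))))

  evalPoly-ℤ→ℚ-≢0 : ∀ p x → ⟦ p ⟧ x ≢ 0ℤ → evalPoly (map ℤ→ℚ p) (ℤ→ℚ x) ≢ 0ℚ
  evalPoly-ℤ→ℚ-≢0 p x ⟦p⟧≢0 eq =
    ⟦p⟧≢0 (ℤ→ℚ-injective-0 (⟦ p ⟧ x) (trans (≡.sym (evalPoly-ℤ→ℚ p x)) eq))

  evalPoly-ℤ→ℚ-cross : ∀ p q x (a b : ℤ) → ⟦ q ⟧ x * a ≡ ⟦ p ⟧ x * b →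
    evalPoly (map ℤ→ℚ q) (ℤ→ℚ x) ℚ.* ℤ→ℚ a ≡ evalPoly (map ℤ→ℚ p) (ℤ→ℚ x) ℚ.* ℤ→ℚ b
  evalPoly-ℤ→ℚ-cross p q x a b eq = begin
    evalPoly (map ℤ→ℚ q) (ℤ→ℚ x) ℚ.* ℤ→ℚ a ≡⟨ cong (ℚ._* ℤ→ℚ a) (evalPoly-ℤ→ℚ q x) ⟩
    ℤ→ℚ (⟦ q ⟧ x) ℚ.* ℤ→ℚ a                ≡⟨ ≡.sym (ℤ→ℚ-* (⟦ q ⟧ x) a) ⟩
    ℤ→ℚ (⟦ q ⟧ x * a)                       ≡⟨ cong ℤ→ℚ eq ⟩
    ℤ→ℚ (⟦ p ⟧ x * b)                       ≡⟨ ℤ→ℚ-* (⟦ p ⟧ x) b ⟩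
    ℤ→ℚ (⟦ p ⟧ x) ℚ.* ℤ→ℚ b                ≡⟨ cong (ℚ._* ℤ→ℚ b) (≡.sym (evalPoly-ℤ→ℚ p x)) ⟩
    evalPoly (map ℤ→ℚ p) (ℤ→ℚ x) ℚ.* ℤ→ℚ b ∎
    where open ≡-Reasoning


module RationalFunction where

  open import Data.Nat using (ℕ; suc; _∸_; _≤_; ∣_-_∣)
  import Data.Nat as ℕ
  import Data.Nat.Properties as ℕ
  open import Data.Nat.Tactic.RingSolver using () renaming (solve-∀ to ℕ-solve-∀)
  open import Data.Nat.Combinatorics using (_C_)
  open import Data.Nat.ListAction using (sum)
  open import Data.Integer using (ℤ; +_; -_; 1ℤ; _+_; _*_; _-_)
  open import Data.Integer.Properties using (*-assoc)
  open import Data.Integer.Tactic.RingSolver using (solve-∀)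
  open import Data.List using (List; []; _∷_)
  open import Data.List.Relation.Unary.All using (All)
  open import Data.Product using (_,_)
  open import Relation.Binary.PropositionalEquality
    using (_≡_; sym; trans; cong; cong₂; module ≡-Reasoning)
  open ≡-Reasoning
  open import Defs using (φ2)
  open Sums
  open Binomial
  open Series
  open HookSquareSum
  open Polynomial

  -- S_{μ₀}(n) = numerator(n) / denominator(n), where denominator(n) = (2n − 2s − 1)⋯(2n − 2), s = |μ₀|.
  denominator : List ℕ → List ℤ
  denominator μ₀ = risingₚ (- (+ 2 * + suc s) ∷ + 2 ∷ []) (s ℕ.+ s)
    where s = sum μ₀

  ratioₚ : ℕ → ℕ → List ℤ
  ratioₚ s κ =
    risingₚ (+ κ - + suc s ∷ 1ℤ ∷ []) (s ∸ κ) *ₚ risingₚ (- + κ - + suc s ∷ 1ℤ ∷ []) (s ℕ.+ κ)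

  numerator : List ℕ → List ℤ
  numerator μ₀ =
    ∑ₚ (monomials μ₀) λ (c , d) → ∑ₚ (monomials μ₀) λ (c′ , d′) → (c * c′) ·ₚ ratioₚ (sum μ₀) ∣ d - d′ ∣

  module _ (μ₀ : List ℕ) (M : ℕ) where

    private
      s = sum μ₀
      n = suc (s ℕ.+ M)
      T = monomials μ₀

      R : ℕ → ℤ
      R κ = rising (+ (M ℕ.+ κ)) (s ∸ κ) * rising (+ M - + κ) (s ℕ.+ κ)

      K : ℤ
      K = binomial (M ℕ.+ M ℕ.+ (s ℕ.+ s)) (M ℕ.+ s)

    ⟦denominator⟧ : ⟦ denominator μ₀ ⟧ (+ n) ≡ rising (+ (M ℕ.+ M)) (s ℕ.+ s)
    ⟦denominator⟧ =
      trans (⟦risingₚ⟧ (- (+ 2 * + suc s) ∷ + 2 ∷ []) (s ℕ.+ s) (+ n))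
            (cong (λ x → rising x (s ℕ.+ s)) (at-n (+ s) (+ M)))
      where
      at-n : ∀ s M → - (+ 2 * (1ℤ + s)) + (1ℤ + (s + M)) * (+ 2 + (1ℤ + (s + M)) * + 0) ≡ M + M
      at-n = solve-∀

    ⟦ratioₚ⟧ : ∀ κ → ⟦ ratioₚ s κ ⟧ (+ n) ≡ R κ
    ⟦ratioₚ⟧ κ =
      trans (⟦*ₚ⟧ (risingₚ up (s ∸ κ)) (risingₚ down (s ℕ.+ κ)) (+ n))
            (cong₂ _*_
              (trans (⟦risingₚ⟧ up (s ∸ κ) (+ n))
                     (cong (λ x → rising x (s ∸ κ)) (up-at-n (+ κ) (+ s) (+ M))))
              (trans (⟦risingₚ⟧ down (s ℕ.+ κ) (+ n))
                     (cong (λ x → rising x (s ℕ.+ κ)) (down-at-n (+ κ) (+ s) (+ M)))))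
      where
      up down : List ℤ
      up   = + κ - + suc s ∷ 1ℤ ∷ []
      down = - + κ - + suc s ∷ 1ℤ ∷ []
      up-at-n : ∀ κ s M → κ - (1ℤ + s) + (1ℤ + (s + M)) * (1ℤ + (1ℤ + (s + M)) * + 0) ≡ M + κ
      up-at-n = solve-∀
      down-at-n : ∀ κ s M → - κ - (1ℤ + s) + (1ℤ + (s + M)) * (1ℤ + (1ℤ + (s + M)) * + 0) ≡ M - κ
      down-at-n = solve-∀

    ⟦numerator⟧ : ⟦ numerator μ₀ ⟧ (+ n) ≡ ∑[ (c , d) ∈ T ] ∑[ (c′ , d′) ∈ T ] (c * c′ * R ∣ d - d′ ∣)
    ⟦numerator⟧ =
      trans (⟦∑ₚ⟧ T _ (+ n)) (∑∈-cong T λ (c , d) →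
      trans (⟦∑ₚ⟧ T _ (+ n)) (∑∈-cong T λ (c′ , d′) →
      trans (⟦·ₚ⟧ (c * c′) (ratioₚ s ∣ d - d′ ∣) (+ n)) (cong (c * c′ *_) (⟦ratioₚ⟧ ∣ d - d′ ∣))))

    central-binomial : K ≡ + ((2 ℕ.* n ∸ 2) C (n ∸ 1))
    central-binomial =
      trans (binomial≡C (M ℕ.+ M ℕ.+ (s ℕ.+ s)) (M ℕ.+ s))
            (cong +_ (cong₂ _C_ (cong (_∸ 2) (sym (double s M))) (ℕ.+-comm M s)))
      where
      double : ∀ s M → 2 ℕ.* suc (s ℕ.+ M) ≡ 2 ℕ.+ (M ℕ.+ M ℕ.+ (s ℕ.+ s))
      double = ℕ-solve-∀

    integer-identity : All (1 ≤_) μ₀ →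
      ⟦ denominator μ₀ ⟧ (+ n) * φ2 μ₀ n ≡ ⟦ numerator μ₀ ⟧ (+ n) * + ((2 ℕ.* n ∸ 2) C (n ∸ 1))
    integer-identity 1≤μ₀ = begin
      ⟦ denominator μ₀ ⟧ (+ n) * φ2 μ₀ n
        ≡⟨ cong₂ _*_ ⟦denominator⟧ (φ2-expansion μ₀ 1≤μ₀ M) ⟩
      D * ∑[ (c , d) ∈ T ] ∑[ (c′ , d′) ∈ T ] (c * c′ * binomial (M ℕ.+ M) (M ℕ.+ ∣ d - d′ ∣))
        ≡⟨ sym (trans (∑∈-cong T (λ _ → ∑∈-*ˡ T D _)) (∑∈-*ˡ T D _)) ⟩
      ∑[ (c , d) ∈ T ] ∑[ (c′ , d′) ∈ T ] (D * (c * c′ * binomial (M ℕ.+ M) (M ℕ.+ ∣ d - d′ ∣)))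
        ≡⟨ ∑∈-congᴬ (monomials-degree μ₀) (λ (c , d) d≤s →
             ∑∈-congᴬ (monomials-degree μ₀) (λ (c′ , d′) d′≤s →
               rescale c c′ (ℕ.≤-trans (ℕ.∣m-n∣≤m⊔n d d′) (ℕ.⊔-lub d≤s d′≤s)))) ⟩
      ∑[ (c , d) ∈ T ] ∑[ (c′ , d′) ∈ T ] (c * c′ * R ∣ d - d′ ∣ * K)
        ≡⟨ trans (∑∈-cong T (λ _ → ∑∈-*ʳ T K _)) (∑∈-*ʳ T K _) ⟩
      (∑[ (c , d) ∈ T ] ∑[ (c′ , d′) ∈ T ] (c * c′ * R ∣ d - d′ ∣)) * K
        ≡⟨ cong₂ _*_ (sym ⟦numerator⟧) central-binomial ⟩
      ⟦ numerator μ₀ ⟧ (+ n) * + ((2 ℕ.* n ∸ 2) C (n ∸ 1)) ∎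
      where
      D = rising (+ (M ℕ.+ M)) (s ℕ.+ s)
      rescale : ∀ c c′ {κ} → κ ≤ s →
                D * (c * c′ * binomial (M ℕ.+ M) (M ℕ.+ κ)) ≡ c * c′ * R κ * K
      rescale c c′ {κ} κ≤s = begin
        D * (c * c′ * binomial (M ℕ.+ M) (M ℕ.+ κ)) ≡⟨ regroup D (c * c′) _ ⟩
        c * c′ * (binomial (M ℕ.+ M) (M ℕ.+ κ) * D) ≡⟨ cong (c * c′ *_) (binomial-ratio M s κ κ≤s) ⟩
        c * c′ * (R κ * K)                          ≡⟨ sym (*-assoc (c * c′) (R κ) K) ⟩
        c * c′ * R κ * K                            ∎
        where
        regroup : ∀ d a b → d * (a * b) ≡ a * (b * d)
        regroup = solve-∀


open import Defs
open import Data.Nat using (ℕ; _≤_; _≥_; suc; _∸_) renaming (_*_ to _*ℕ_)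
open import Data.Nat.Combinatorics using (_C_)
open import Data.List using (List)
open import Data.Nat.ListAction using (sum)
open import Data.List.Relation.Unary.All using (All)
open import Data.List.Relation.Unary.Linked using (Linked)
open import Data.Rational using (ℚ; 0ℚ; _*_)
open import Data.Product using (Σ; _×_)
open import Relation.Binary.PropositionalEquality using (_≡_; _≢_)

import Data.Nat as ℕ
import Data.Nat.Properties as ℕ
open import Data.Integer using (+_)
open import Data.List using (map)
import Data.List.Relation.Unary.All as All
open import Data.Product using (_,_)
open import Relation.Binary.PropositionalEquality using (refl; sym; trans)
open Binomial using (rising-≢0)
open Polynomial using (evalPoly-ℤ→ℚ-≢0; evalPoly-ℤ→ℚ-cross)
open RationalFunction

mainTheorem4 : (μ₀ : List ℕ) → Linked _≥_ μ₀ → All (2 ≤_) μ₀ →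
    Σ (List ℚ) λ P → Σ (List ℚ) λ Q →
      ∀ (n : ℕ) → suc (sum μ₀) ≤ n →
        (evalPoly Q (ℕ→ℚ n) ≢ 0ℚ) ×
        (evalPoly Q (ℕ→ℚ n) * ℤ→ℚ (φ2 μ₀ n) ≡ evalPoly P (ℕ→ℚ n) * ℕ→ℚ ((2 *ℕ n ∸ 2) C (n ∸ 1)))
mainTheorem4 μ₀ _ 2≤μ₀ = map ℤ→ℚ (numerator μ₀) , map ℤ→ℚ (denominator μ₀) , at
  where
  at : ∀ n → suc (sum μ₀) ≤ n →
    (evalPoly (map ℤ→ℚ (denominator μ₀)) (ℕ→ℚ n) ≢ 0ℚ) ×
    (evalPoly (map ℤ→ℚ (denominator μ₀)) (ℕ→ℚ n) * ℤ→ℚ (φ2 μ₀ n)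
       ≡ evalPoly (map ℤ→ℚ (numerator μ₀)) (ℕ→ℚ n) * ℕ→ℚ ((2 *ℕ n ∸ 2) C (n ∸ 1)))
  at n s<n with ℕ.m≤n⇒∃[o]m+o≡n s<n
  ... | M , refl =
    evalPoly-ℤ→ℚ-≢0 (denominator μ₀) (+ n)
      (λ eq → rising-≢0 (M ℕ.+ M) (sum μ₀ ℕ.+ sum μ₀) (trans (sym (⟦denominator⟧ μ₀ M)) eq)) ,
    evalPoly-ℤ→ℚ-cross (numerator μ₀) (denominator μ₀) (+ n) (φ2 μ₀ n) _
      (integer-identity μ₀ M (All.map (ℕ.≤-trans (ℕ.s≤s ℕ.z≤n)) 2≤μ₀))
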